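{- Let $S=\{213,231,312,321\}$ and let $t_n$ be the number of rooted labeled trees on $[n]$ avoiding $S$ (with $t_0=0$). Then the exponential generating function $T(x)=\sum_{n\ge0}t_nx^n/n!$ satisfies the differential equation $T'=T+e^T$ with initial condition $T(0)=0$.
   Context: A pattern is a permutation of $[k]$. A rooted labeled tree on $[n]$ is an unordered tree on $n$ vertices with distinct labels in $[n]$ and a distinguished root. A tree avoids $S$ if there is no sequence of vertices $v_1,\dots,v_k$ with $v_i$ an ancestor of $v_{i+1}$ whose labels are in the same relative order as some $\pi\in S$ of length $k$. -}

module Defs where

open import Data.Nat as ℕ using (ℕ; zero; suc; _∸_; _<ᵇ_; _≡ᵇ_; _!)
open import Data.Nat.Properties using (_!≢0)
open import Data.Fin using (Fin; toℕ)
open import Data.Maybe using (Maybe; just; nothing; is-nothing; _>>=_)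
open import Data.Vec as Vec using (Vec; []; _∷_; lookup)
open import Data.List as List using (List; []; _∷_; [_]; map; concatMap; length; filterᵇ; upTo; allFin; zip)
open import Data.Bool.ListAction using (any; all)
open import Data.Bool using (Bool; true; false; _∧_; not; if_then_else_)
open import Data.Product using (_,_; _×_)
open import Data.Integer using (+_)
open import Data.Rational as ℚ using (ℚ; _/_; 0ℚ; 1ℚ; _+_; _*_)

-- Vertex labels 1..n are represented by Fin n (label = toℕ v + 1; only
-- relative order matters).  A rooted labeled (unordered) tree on [n] is
-- encoded bijectively by its parent map p : Vec (Maybe (Fin n)) n:
-- p[v] = nothing iff v is the root, p[v] = just u iff u is the parent of v.
-- A parent map is a rooted tree iff exactly one vertex has no parent and
-- every vertex reaches the root by iterating the parent map (no cycles).

ParentMap : ℕ → Set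
ParentMap n = Vec (Maybe (Fin n)) n

_==F_ : ∀ {n} → Fin n → Fin n → Bool
u ==F v = toℕ u ≡ᵇ toℕ v

-- k-fold iterate of the parent map (nothing = fell off above the root)
up : ∀ {n} → ParentMap n → ℕ → Fin n → Maybe (Fin n)
up p zero    v = just v
up p (suc k) v = up p k v >>= lookup p

is-justF : ∀ {n} → Fin n → Maybe (Fin n) → Bool
is-justF u (just w) = u ==F w
is-justF u nothing  = false

isAncestor : ∀ {n} → ParentMap n → Fin n → Fin n → Bool
isAncestor {n} p u v = any (λ k → is-justF u (up p (suc k) v)) (upTo n)

isTree : ∀ {n} → ParentMap n → Bool
isTree {n} p =
  (length (filterᵇ is-nothing (Vec.toList p)) ≡ᵇ 1)
  ∧ all (λ v → is-nothing (up p n v)) (allFin n)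

-- a pattern is a permutation of [k], written as the list π₁ … π_k
Pattern : Set
Pattern = List ℕ

isChain : ∀ {n} → ParentMap n → List (Fin n) → Bool
isChain p (u ∷ v ∷ vs) = isAncestor p u v ∧ isChain p (v ∷ vs)
isChain p _            = true

_==B_ : Bool → Bool → Bool
true  ==B b = b
false ==B b = not b

sameOrder : List ℕ → List ℕ → Bool
sameOrder xs ys =
  (length xs ≡ᵇ length ys)
  ∧ all (λ { ((a , b) , (c , d)) → (a <ᵇ c) ==B (b <ᵇ d) }) (List.cartesianProduct zs zs)
  where zs = zip xs ys

listsOver : ∀ {A : Set} → List A → ℕ → List (List A)
listsOver xs zero    = [ [] ]
listsOver xs (suc k) = concatMap (λ x → map (x ∷_) (listsOver xs k)) xs

vecsOver : ∀ {A : Set} → List A → (k : ℕ) → List (Vec A k)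
vecsOver xs zero    = [ [] ]
vecsOver xs (suc k) = concatMap (λ x → map (x ∷_) (vecsOver xs k)) xs

contains : ∀ {n} → ParentMap n → Pattern → Bool
contains {n} p π =
  any (λ vs → isChain p vs ∧ sameOrder (map toℕ vs) π) (listsOver (allFin n) (length π))

avoids : ∀ {n} → ParentMap n → List Pattern → Bool
avoids p S = all (λ π → not (contains p π)) S

allParentMaps : (n : ℕ) → List (ParentMap n)
allParentMaps n = vecsOver (nothing ∷ map just (allFin n)) n

-- t_n = number of rooted labeled trees on [n] avoiding S (t_0 = 0 automatically)
numAvoidingTrees : List Pattern → ℕ → ℕ
numAvoidingTrees S n = length (filterᵇ (λ p → isTree p ∧ avoids p S) (allParentMaps n))

S₀ : List Pattern
S₀ = (2 ∷ 1 ∷ 3 ∷ []) ∷ (2 ∷ 3 ∷ 1 ∷ []) ∷ (3 ∷ 1 ∷ 2 ∷ []) ∷ (3 ∷ 2 ∷ 1 ∷ []) ∷ []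

Series : Set
Series = ℕ → ℚ

sumTo : ℕ → (ℕ → ℚ) → ℚ
sumTo zero    f = f 0
sumTo (suc n) f = sumTo n f + f (suc n)

_⊛_ : Series → Series → Series
(f ⊛ g) n = sumTo n (λ i → f i * g (n ∸ i))

one : Series
one zero    = 1ℚ
one (suc n) = 0ℚ

pow : Series → ℕ → Series
pow f zero    = one
pow f (suc k) = f ⊛ pow f k

invFact : ℕ → ℚ
invFact k = _/_ (+ 1) (k !) {{k !≢0}}

-- e^f = Σ_k f^k / k!.  Meaningful (and used) only when f 0 = 0, in which
-- case f^k has no terms below degree k, so the coefficient of x^n is the
-- finite sum over k ≤ n below.
expS : Series → Series
expS f n = sumTo n (λ k → invFact k * pow f k n)

deriv : Series → Series
deriv f n = (+ (suc n) / 1) * f (suc n)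

_⊕_ : Series → Series → Series
(f ⊕ g) n = f n + g n

egf : (ℕ → ℕ) → Series
egf t n = _/_ (+ t n) (n !) {{n !≢0}}

module Submission where

-- Avoiding S₀ = {213, 231, 312, 321} says exactly that along every ancestor chain
-- u, v, w the top vertex u carries the smallest label.  Let F(n, k) count the forests
-- on n vertices made of k such trees.  Deleting the vertex with the smallest label gives
--   F(n+1, k+1) = (k+1) F(n, k+1) + Σⱼ C(j, k) F(n, j):
-- that vertex is either a leaf hanging from one of the k+1 roots, or a root that adopts
-- j − k of the j roots of the remaining forest.  For T the egf of F(·, 1), the
-- recurrence yields Tᵏ = k! Σₙ F(n, k) xⁿ/n! by induction on the degree, comparing
-- (Tᵏ⁺¹)′ = (k+1) Tᵏ T′ with T′ = T + e^T in lower degrees; the case k = 0 of the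
-- recurrence then reads T′ = T + Σⱼ Tʲ/j! = T + e^T.

open import Defs
open import Data.Nat as ℕ using (ℕ; suc; _<_)
open import Data.Nat.Combinatorics using (_C_)
open import Data.Product using (_×_)
open import Relation.Binary.PropositionalEquality using (_≡_; refl)
open import Data.Rational using (0ℚ)


module NatCast where

  open import Data.Nat as ℕ using (ℕ; suc; _!)
  open import Data.Nat.Properties as ℕP using (_!≢0)
  open import Data.Integer as ℤ using (+_)
  import Data.Integer.Properties as ℤP
  open import Data.Rational using (ℚ; _/_; 1ℚ; _+_; _*_; toℚᵘ)
  import Data.Rational.Properties as ℚP
  open import Data.Rational.Solver using (module +-*-Solver)
  open import Data.Rational.Unnormalised as ℚᵘ using (mkℚᵘ; *≡*; _≃_)
  import Data.Rational.Unnormalised.Properties as ℚᵘP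
  open import Relation.Binary.PropositionalEquality

  private
    toℚᵘ-/ : ∀ a b → toℚᵘ (+ a / suc b) ≃ mkℚᵘ (+ a) b
    toℚᵘ-/ a b = ℚP.toℚᵘ-fromℚᵘ (mkℚᵘ (+ a) b)

    /-cong-cross : ∀ a b c d .{{_ : ℕ.NonZero b}} .{{_ : ℕ.NonZero d}} →
                   a ℕ.* d ≡ c ℕ.* b → + a / b ≡ + c / d
    /-cong-cross a (suc b) c (suc d) eq = ℚP.toℚᵘ-injective (begin
      toℚᵘ (+ a / suc b)  ≈⟨ toℚᵘ-/ a b ⟩
      mkℚᵘ (+ a) b        ≈⟨ *≡* cross ⟩
      mkℚᵘ (+ c) d        ≈⟨ toℚᵘ-/ c d ⟨
      toℚᵘ (+ c / suc d)  ∎)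
      where
      open ℚᵘP.≃-Reasoning
      cross : + a ℤ.* + suc d ≡ + c ℤ.* + suc b
      cross = trans (sym (ℤP.pos-* a (suc d))) (trans (cong +_ eq) (ℤP.pos-* c (suc b)))

    /-* : ∀ a b c d .{{_ : ℕ.NonZero b}} .{{_ : ℕ.NonZero d}} →
          (+ a / b) * (+ c / d) ≡ (+ (a ℕ.* c) / (b ℕ.* d)) {{ℕP.m*n≢0 b d}}
    /-* a (suc b) c (suc d) = ℚP.toℚᵘ-injective (begin
      toℚᵘ ((+ a / suc b) * (+ c / suc d))
        ≈⟨ ℚP.toℚᵘ-homo-* (+ a / suc b) (+ c / suc d) ⟩
      toℚᵘ (+ a / suc b) ℚᵘ.* toℚᵘ (+ c / suc d)
        ≈⟨ ℚᵘP.*-cong (toℚᵘ-/ a b) (toℚᵘ-/ c d) ⟩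
      mkℚᵘ (+ a ℤ.* + c) (ℕ.pred (suc b ℕ.* suc d))
        ≡⟨ cong (λ x → mkℚᵘ x (ℕ.pred (suc b ℕ.* suc d))) (sym (ℤP.pos-* a c)) ⟩
      mkℚᵘ (+ (a ℕ.* c)) (ℕ.pred (suc b ℕ.* suc d))
        ≈⟨ toℚᵘ-/ (a ℕ.* c) (ℕ.pred (suc b ℕ.* suc d)) ⟨
      toℚᵘ (+ (a ℕ.* c) / suc (ℕ.pred (suc b ℕ.* suc d))) ∎)
      where open ℚᵘP.≃-Reasoning

    /-+ : ∀ a b c d .{{_ : ℕ.NonZero b}} .{{_ : ℕ.NonZero d}} →
          (+ a / b) + (+ c / d) ≡ (+ (a ℕ.* d ℕ.+ c ℕ.* b) / (b ℕ.* d)) {{ℕP.m*n≢0 b d}}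
    /-+ a (suc b) c (suc d) = ℚP.toℚᵘ-injective (begin
      toℚᵘ ((+ a / suc b) + (+ c / suc d))
        ≈⟨ ℚP.toℚᵘ-homo-+ (+ a / suc b) (+ c / suc d) ⟩
      toℚᵘ (+ a / suc b) ℚᵘ.+ toℚᵘ (+ c / suc d)
        ≈⟨ ℚᵘP.+-cong (toℚᵘ-/ a b) (toℚᵘ-/ c d) ⟩
      mkℚᵘ (+ a ℤ.* + suc d ℤ.+ + c ℤ.* + suc b) (ℕ.pred (suc b ℕ.* suc d))
        ≡⟨ cong (λ x → mkℚᵘ x (ℕ.pred (suc b ℕ.* suc d))) numerator ⟩
      mkℚᵘ (+ (a ℕ.* suc d ℕ.+ c ℕ.* suc b)) (ℕ.pred (suc b ℕ.* suc d))
        ≈⟨ toℚᵘ-/ (a ℕ.* suc d ℕ.+ c ℕ.* suc b) (ℕ.pred (suc b ℕ.* suc d)) ⟨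
      toℚᵘ (+ (a ℕ.* suc d ℕ.+ c ℕ.* suc b) / suc (ℕ.pred (suc b ℕ.* suc d))) ∎)
      where
      open ℚᵘP.≃-Reasoning
      numerator : + a ℤ.* + suc d ℤ.+ + c ℤ.* + suc b ≡ + (a ℕ.* suc d ℕ.+ c ℕ.* suc b)
      numerator = trans (cong₂ ℤ._+_ (sym (ℤP.pos-* a (suc d))) (sym (ℤP.pos-* c (suc b))))
                        (sym (ℤP.pos-+ (a ℕ.* suc d) (c ℕ.* suc b)))

  fromℕ : ℕ → ℚ
  fromℕ n = + n / 1

  fromℕ-+ : ∀ m n → fromℕ (m ℕ.+ n) ≡ fromℕ m + fromℕ n
  fromℕ-+ m n = sym (trans (/-+ m 1 n 1) (/-cong-cross (m ℕ.* 1 ℕ.+ n ℕ.* 1) 1 (m ℕ.+ n) 1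
    (cong₂ (λ x y → (x ℕ.+ y) ℕ.* 1) (ℕP.*-identityʳ m) (ℕP.*-identityʳ n))))

  fromℕ-* : ∀ m n → fromℕ (m ℕ.* n) ≡ fromℕ m * fromℕ n
  fromℕ-* m n = sym (trans (/-* m 1 n 1) (/-cong-cross (m ℕ.* n) 1 (m ℕ.* n) 1 refl))

  egf≡fromℕ*invFact : ∀ (t : ℕ → ℕ) n → egf t n ≡ fromℕ (t n) * invFact n
  egf≡fromℕ*invFact t n = sym (trans (/-* (t n) 1 1 (n !) {{_}} {{n !≢0}})
    (/-cong-cross (t n ℕ.* 1) (1 ℕ.* n !) (t n) (n !) {{ℕP.m*n≢0 1 (n !) {{_}} {{n !≢0}}}} {{n !≢0}}
      (cong₂ ℕ._*_ (ℕP.*-identityʳ (t n)) (sym (ℕP.*-identityˡ (n !))))))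

  fromℕ[n!]*invFact[n]≡1 : ∀ n → fromℕ (n !) * invFact n ≡ 1ℚ
  fromℕ[n!]*invFact[n]≡1 n = trans (/-* (n !) 1 1 (n !) {{_}} {{n !≢0}})
    (/-cong-cross (n ! ℕ.* 1) (1 ℕ.* n !) 1 1 {{ℕP.m*n≢0 1 (n !) {{_}} {{n !≢0}}}}
      (trans (ℕP.*-identityʳ _) (trans (ℕP.*-identityʳ _) (sym (trans (ℕP.*-identityˡ _) (ℕP.*-identityˡ _))))))

  fromℕ[1+n]*invFact[1+n]≡invFact[n] : ∀ n → fromℕ (suc n) * invFact (suc n) ≡ invFact n
  fromℕ[1+n]*invFact[1+n]≡invFact[n] n = trans (/-* (suc n) 1 1 (suc n !) {{_}} {{suc n !≢0}})
    (/-cong-cross (suc n ℕ.* 1) (1 ℕ.* suc n !) 1 (n !) {{ℕP.m*n≢0 1 (suc n !) {{_}} {{suc n !≢0}}}} {{n !≢0}}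
      (trans (cong (ℕ._* n !) (ℕP.*-identityʳ (suc n))) (sym (trans (ℕP.*-identityˡ _) (ℕP.*-identityˡ _)))))

  *-cancelˡ-fromℕ-suc : ∀ n {x y} → fromℕ (suc n) * x ≡ fromℕ (suc n) * y → x ≡ y
  *-cancelˡ-fromℕ-suc n {x} {y} eq = begin
    x                                           ≡⟨ undo x ⟨
    (fromℕ (suc n) * x) * (invFact (suc n) * fromℕ (n !))
                                                ≡⟨ cong (_* (invFact (suc n) * fromℕ (n !))) eq ⟩
    (fromℕ (suc n) * y) * (invFact (suc n) * fromℕ (n !))
                                                ≡⟨ undo y ⟩
    y                                           ∎
    where
    open ≡-Reasoning
    open +-*-Solver
    undo : ∀ z → (fromℕ (suc n) * z) * (invFact (suc n) * fromℕ (n !)) ≡ z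
    undo z = begin
      (fromℕ (suc n) * z) * (invFact (suc n) * fromℕ (n !))
        ≡⟨ solve 4 (λ z a b c → (a :* z) :* (b :* c) := z :* (c :* (a :* b))) refl
             z (fromℕ (suc n)) (invFact (suc n)) (fromℕ (n !)) ⟩
      z * (fromℕ (n !) * (fromℕ (suc n) * invFact (suc n)))
        ≡⟨ cong (λ w → z * (fromℕ (n !) * w)) (fromℕ[1+n]*invFact[1+n]≡invFact[n] n) ⟩
      z * (fromℕ (n !) * invFact n)
        ≡⟨ cong (z *_) (fromℕ[n!]*invFact[n]≡1 n) ⟩
      z * 1ℚ
        ≡⟨ ℚP.*-identityʳ z ⟩
      z ∎


module FiniteSum where

  open import Data.Nat as ℕ using (ℕ; zero; suc; _∸_; _≤_; _<_; z≤n; s≤s)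
  import Data.Nat.Properties as ℕP
  open import Data.Rational using (ℚ; 0ℚ; _+_; _*_)
  import Data.Rational.Properties as ℚP
  open import Data.Rational.Solver using (module +-*-Solver)
  open import Data.Sum using (inj₁; inj₂)
  open import Function using (_∘_)
  open import Relation.Binary.PropositionalEquality
  open NatCast using (fromℕ; fromℕ-+)

  sumTo-cong≤ : ∀ n {f g : ℕ → ℚ} → (∀ i → i ≤ n → f i ≡ g i) → sumTo n f ≡ sumTo n g
  sumTo-cong≤ zero    f≡g = f≡g 0 z≤n
  sumTo-cong≤ (suc n) f≡g =
    cong₂ _+_ (sumTo-cong≤ n (λ i i≤n → f≡g i (ℕP.m≤n⇒m≤1+n i≤n))) (f≡g (suc n) ℕP.≤-refl)

  sumTo-cong : ∀ n {f g : ℕ → ℚ} → (∀ i → f i ≡ g i) → sumTo n f ≡ sumTo n g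
  sumTo-cong n f≡g = sumTo-cong≤ n (λ i _ → f≡g i)

  sumTo-zero : ∀ n {f : ℕ → ℚ} → (∀ i → i ≤ n → f i ≡ 0ℚ) → sumTo n f ≡ 0ℚ
  sumTo-zero zero    f≡0 = f≡0 0 z≤n
  sumTo-zero (suc n) f≡0 =
    cong₂ _+_ (sumTo-zero n (λ i i≤n → f≡0 i (ℕP.m≤n⇒m≤1+n i≤n))) (f≡0 (suc n) ℕP.≤-refl)

  sumTo-+ : ∀ n (f g : ℕ → ℚ) → sumTo n (λ i → f i + g i) ≡ sumTo n f + sumTo n g
  sumTo-+ zero    f g = refl
  sumTo-+ (suc n) f g = trans (cong (_+ (f (suc n) + g (suc n))) (sumTo-+ n f g))
    (solve 4 (λ a b c d → (a :+ b) :+ (c :+ d) := (a :+ c) :+ (b :+ d)) refl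
      (sumTo n f) (sumTo n g) (f (suc n)) (g (suc n)))
    where open +-*-Solver

  *-distribˡ-sumTo : ∀ n c (f : ℕ → ℚ) → c * sumTo n f ≡ sumTo n (λ i → c * f i)
  *-distribˡ-sumTo zero    c f = refl
  *-distribˡ-sumTo (suc n) c f = trans (ℚP.*-distribˡ-+ c (sumTo n f) (f (suc n)))
    (cong (_+ c * f (suc n)) (*-distribˡ-sumTo n c f))

  *-distribʳ-sumTo : ∀ n c (f : ℕ → ℚ) → sumTo n f * c ≡ sumTo n (λ i → f i * c)
  *-distribʳ-sumTo n c f = trans (ℚP.*-comm (sumTo n f) c)
    (trans (*-distribˡ-sumTo n c f) (sumTo-cong n (λ i → ℚP.*-comm c (f i))))

  sumTo-suc-head : ∀ n (f : ℕ → ℚ) → sumTo (suc n) f ≡ f 0 + sumTo n (f ∘ suc)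
  sumTo-suc-head zero    f = refl
  sumTo-suc-head (suc n) f =
    trans (cong (_+ f (suc (suc n))) (sumTo-suc-head n f)) (ℚP.+-assoc (f 0) _ _)

  sumTo-comm : ∀ n m (h : ℕ → ℕ → ℚ) →
               sumTo n (λ i → sumTo m (h i)) ≡ sumTo m (λ j → sumTo n (λ i → h i j))
  sumTo-comm zero    m h = refl
  sumTo-comm (suc n) m h = trans (cong (_+ sumTo m (h (suc n))) (sumTo-comm n m h))
    (sym (sumTo-+ m (λ j → sumTo n (λ i → h i j)) (h (suc n))))

  sumTo-reverse : ∀ n (f : ℕ → ℚ) → sumTo n f ≡ sumTo n (λ i → f (n ∸ i))
  sumTo-reverse zero    f = refl
  sumTo-reverse (suc n) f = trans (cong (_+ f (suc n)) (sumTo-reverse n f))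
    (trans (ℚP.+-comm _ (f (suc n))) (sym (sumTo-suc-head n (λ i → f (suc n ∸ i)))))

  sumTo-triangle : ∀ n (φ : ℕ → ℕ → ℚ) →
    sumTo n (λ i → sumTo i (λ a → φ a i)) ≡ sumTo n (λ a → sumTo (n ∸ a) (λ b → φ a (a ℕ.+ b)))
  sumTo-triangle zero    φ = refl
  sumTo-triangle (suc n) φ = begin
    sumTo (suc n) (λ i → sumTo i (λ a → φ a i))
      ≡⟨ sumTo-suc-head n (λ i → sumTo i (λ a → φ a i)) ⟩
    φ 0 0 + sumTo n (λ i → sumTo (suc i) (λ a → φ a (suc i)))
      ≡⟨ cong (φ 0 0 +_) (sumTo-cong n (λ i → sumTo-suc-head i (λ a → φ a (suc i)))) ⟩
    φ 0 0 + sumTo n (λ i → φ 0 (suc i) + sumTo i (λ a → φ (suc a) (suc i)))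
      ≡⟨ cong (φ 0 0 +_) (sumTo-+ n (λ i → φ 0 (suc i)) (λ i → sumTo i (λ a → φ (suc a) (suc i)))) ⟩
    φ 0 0 + (sumTo n (λ i → φ 0 (suc i)) + sumTo n (λ i → sumTo i (λ a → φ (suc a) (suc i))))
      ≡⟨ ℚP.+-assoc (φ 0 0) _ _ ⟨
    (φ 0 0 + sumTo n (λ i → φ 0 (suc i))) + sumTo n (λ i → sumTo i (λ a → φ (suc a) (suc i)))
      ≡⟨ cong₂ _+_ (sym (sumTo-suc-head n (φ 0))) (sumTo-triangle n (λ a i → φ (suc a) (suc i))) ⟩
    sumTo (suc n) (φ 0) + sumTo n (λ a → sumTo (n ∸ a) (λ b → φ (suc a) (suc a ℕ.+ b)))
      ≡⟨ sumTo-suc-head n (λ a → sumTo (suc n ∸ a) (λ b → φ a (a ℕ.+ b))) ⟨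
    sumTo (suc n) (λ a → sumTo (suc n ∸ a) (λ b → φ a (a ℕ.+ b))) ∎
    where open ≡-Reasoning

  sumTo-extend : ∀ m n (f : ℕ → ℚ) → m ≤ n → (∀ i → m < i → i ≤ n → f i ≡ 0ℚ) →
                 sumTo m f ≡ sumTo n f
  sumTo-extend m zero    f z≤n _ = refl
  sumTo-extend m (suc n) f m≤1+n f≡0 with ℕP.m≤n⇒m<n∨m≡n m≤1+n
  ... | inj₂ refl       = refl
  ... | inj₁ (s≤s m≤n) = begin
    sumTo m f             ≡⟨ sumTo-extend m n f m≤n (λ i m<i i≤n → f≡0 i m<i (ℕP.m≤n⇒m≤1+n i≤n)) ⟩
    sumTo n f             ≡⟨ ℚP.+-identityʳ _ ⟨
    sumTo n f + 0ℚ        ≡⟨ cong (sumTo n f +_) (f≡0 (suc n) (s≤s m≤n) ℕP.≤-refl) ⟨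
    sumTo (suc n) f       ∎
    where open ≡-Reasoning

  sumTo-dropInitialZeros : ∀ k n (g : ℕ → ℚ) → (∀ j → j < k → g j ≡ 0ℚ) →
                           sumTo (k ℕ.+ n) g ≡ sumTo n (λ i → g (k ℕ.+ i))
  sumTo-dropInitialZeros zero    n g _   = refl
  sumTo-dropInitialZeros (suc k) n g g≡0 = begin
    sumTo (suc k ℕ.+ n) g
      ≡⟨ sumTo-suc-head (k ℕ.+ n) g ⟩
    g 0 + sumTo (k ℕ.+ n) (g ∘ suc)
      ≡⟨ cong₂ _+_ (g≡0 0 (s≤s z≤n)) (sumTo-dropInitialZeros k n (g ∘ suc) (λ j j<k → g≡0 (suc j) (s≤s j<k))) ⟩
    0ℚ + sumTo n (λ i → g (suc k ℕ.+ i))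
      ≡⟨ ℚP.+-identityˡ _ ⟩
    sumTo n (λ i → g (suc k ℕ.+ i)) ∎
    where open ≡-Reasoning

  sumℕTo : ℕ → (ℕ → ℕ) → ℕ
  sumℕTo zero    g = g 0
  sumℕTo (suc n) g = sumℕTo n g ℕ.+ g (suc n)

  sumℕTo-cong : ∀ n {f g : ℕ → ℕ} → (∀ j → f j ≡ g j) → sumℕTo n f ≡ sumℕTo n g
  sumℕTo-cong zero    f≡g = f≡g 0
  sumℕTo-cong (suc n) f≡g = cong₂ ℕ._+_ (sumℕTo-cong n f≡g) (f≡g (suc n))

  fromℕ-sumℕTo : ∀ n g → fromℕ (sumℕTo n g) ≡ sumTo n (λ j → fromℕ (g j))
  fromℕ-sumℕTo zero    g = refl
  fromℕ-sumℕTo (suc n) g =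
    trans (fromℕ-+ (sumℕTo n g) (g (suc n))) (cong (_+ fromℕ (g (suc n))) (fromℕ-sumℕTo n g))


module PowerSeries where

  open import Data.Nat as ℕ using (ℕ; zero; suc; _∸_; _≤_; _<_)
  import Data.Nat.Properties as ℕP
  open import Data.Rational using (ℚ; 0ℚ; 1ℚ; _+_; _*_)
  import Data.Rational.Properties as ℚP
  open import Data.Rational.Solver using (module +-*-Solver)
  open import Relation.Binary.PropositionalEquality
  open NatCast
  open FiniteSum
  open +-*-Solver

  ⊛-congʳ≤ : ∀ n (f : Series) {g g′ : Series} → (∀ i → i ≤ n → g i ≡ g′ i) → (f ⊛ g) n ≡ (f ⊛ g′) n
  ⊛-congʳ≤ n f g≡g′ = sumTo-cong≤ n (λ i _ → cong (f i *_) (g≡g′ (n ∸ i) (ℕP.m∸n≤m n i)))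

  ⊛-comm : ∀ (f g : Series) n → (f ⊛ g) n ≡ (g ⊛ f) n
  ⊛-comm f g n = trans (sumTo-reverse n (λ i → f i * g (n ∸ i)))
    (sumTo-cong≤ n (λ i i≤n → trans (cong (λ x → f (n ∸ i) * g x) (ℕP.m∸[m∸n]≡n i≤n))
                                    (ℚP.*-comm (f (n ∸ i)) (g i))))

  ⊛-assoc : ∀ (f g h : Series) n → ((f ⊛ g) ⊛ h) n ≡ (f ⊛ (g ⊛ h)) n
  ⊛-assoc f g h n = begin
    sumTo n (λ i → sumTo i (λ a → f a * g (i ∸ a)) * h (n ∸ i))
      ≡⟨ sumTo-cong n (λ i → *-distribʳ-sumTo i (h (n ∸ i)) (λ a → f a * g (i ∸ a))) ⟩
    sumTo n (λ i → sumTo i (λ a → f a * g (i ∸ a) * h (n ∸ i)))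
      ≡⟨ sumTo-triangle n (λ a i → f a * g (i ∸ a) * h (n ∸ i)) ⟩
    sumTo n (λ a → sumTo (n ∸ a) (λ b → f a * g (a ℕ.+ b ∸ a) * h (n ∸ (a ℕ.+ b))))
      ≡⟨ sumTo-cong n (λ a → sumTo-cong (n ∸ a) (λ b → reindex a b)) ⟩
    sumTo n (λ a → sumTo (n ∸ a) (λ b → f a * (g b * h (n ∸ a ∸ b))))
      ≡⟨ sumTo-cong n (λ a → *-distribˡ-sumTo (n ∸ a) (f a) (λ b → g b * h (n ∸ a ∸ b))) ⟨
    sumTo n (λ a → f a * sumTo (n ∸ a) (λ b → g b * h (n ∸ a ∸ b))) ∎
    where
    open ≡-Reasoning
    reindex : ∀ a b → f a * g (a ℕ.+ b ∸ a) * h (n ∸ (a ℕ.+ b)) ≡ f a * (g b * h (n ∸ a ∸ b))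
    reindex a b = trans (cong₂ (λ x y → f a * g x * h y) (ℕP.m+n∸m≡n a b) (sym (ℕP.∸-+-assoc n a b)))
                        (ℚP.*-assoc (f a) (g b) (h (n ∸ a ∸ b)))

  ⊛-distribˡ-⊕ : ∀ (f g h : Series) n → (f ⊛ (g ⊕ h)) n ≡ (f ⊛ g) n + (f ⊛ h) n
  ⊛-distribˡ-⊕ f g h n = trans (sumTo-cong n (λ i → ℚP.*-distribˡ-+ (f i) (g (n ∸ i)) (h (n ∸ i))))
    (sumTo-+ n (λ i → f i * g (n ∸ i)) (λ i → f i * h (n ∸ i)))

  ⊛-scaleʳ : ∀ (f g : Series) c n → (f ⊛ (λ m → c * g m)) n ≡ c * (f ⊛ g) n
  ⊛-scaleʳ f g c n = trans
    (sumTo-cong n (λ i → solve 3 (λ x y z → x :* (y :* z) := y :* (x :* z)) refl (f i) c (g (n ∸ i))))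
    (sym (*-distribˡ-sumTo n c (λ i → f i * g (n ∸ i))))

  ⊛-identityʳ : ∀ (f : Series) n → (f ⊛ one) n ≡ f n
  ⊛-identityʳ f zero    = ℚP.*-identityʳ (f 0)
  ⊛-identityʳ f (suc n) = trans (cong₂ _+_ lower-terms top-term) (ℚP.+-identityˡ _)
    where
    lower-terms : sumTo n (λ i → f i * one (suc n ∸ i)) ≡ 0ℚ
    lower-terms = sumTo-zero n (λ i i≤n →
      trans (cong (λ x → f i * one x) (ℕP.+-∸-assoc 1 i≤n)) (ℚP.*-zeroʳ (f i)))
    top-term : f (suc n) * one (n ∸ n) ≡ f (suc n)
    top-term = trans (cong (λ x → f (suc n) * one x) (ℕP.n∸n≡0 n)) (ℚP.*-identityʳ _)

  ⊛-identityˡ : ∀ (f : Series) n → (one ⊛ f) n ≡ f n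
  ⊛-identityˡ f n = trans (⊛-comm one f n) (⊛-identityʳ f n)

  deriv-⊛ : ∀ (f g : Series) n → deriv (f ⊛ g) n ≡ (deriv f ⊛ g) n + (f ⊛ deriv g) n
  deriv-⊛ f g n = begin
    fromℕ N * sumTo N (λ i → f i * g (N ∸ i))
      ≡⟨ *-distribˡ-sumTo N (fromℕ N) (λ i → f i * g (N ∸ i)) ⟩
    sumTo N (λ i → fromℕ N * (f i * g (N ∸ i)))
      ≡⟨ sumTo-cong≤ N split ⟩
    sumTo N (λ i → left i + right i)
      ≡⟨ sumTo-+ N left right ⟩
    sumTo N left + sumTo N right
      ≡⟨ cong₂ _+_ left-sum right-sum ⟩
    (deriv f ⊛ g) n + (f ⊛ deriv g) n ∎
    where
    open ≡-Reasoning
    N = suc n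
    left right : ℕ → ℚ
    left  i = fromℕ i * (f i * g (N ∸ i))
    right i = fromℕ (N ∸ i) * (f i * g (N ∸ i))
    split : ∀ i → i ≤ N → fromℕ N * (f i * g (N ∸ i)) ≡ left i + right i
    split i i≤N = trans (cong (λ x → fromℕ x * (f i * g (N ∸ i))) (sym (ℕP.m+[n∸m]≡n i≤N)))
      (trans (cong (_* (f i * g (N ∸ i))) (fromℕ-+ i (N ∸ i)))
             (ℚP.*-distribʳ-+ (f i * g (N ∸ i)) (fromℕ i) (fromℕ (N ∸ i))))
    left-sum : sumTo N left ≡ (deriv f ⊛ g) n
    left-sum = begin
      sumTo N left                             ≡⟨ sumTo-suc-head n left ⟩
      0ℚ * (f 0 * g N) + sumTo n (λ i → left (suc i))
                                               ≡⟨ cong (_+ sumTo n (λ i → left (suc i))) (ℚP.*-zeroˡ (f 0 * g N)) ⟩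
      0ℚ + sumTo n (λ i → left (suc i))        ≡⟨ ℚP.+-identityˡ _ ⟩
      sumTo n (λ i → left (suc i))
        ≡⟨ sumTo-cong n (λ i → ℚP.*-assoc (fromℕ (suc i)) (f (suc i)) (g (n ∸ i))) ⟨
      (deriv f ⊛ g) n                          ∎
    right-sum : sumTo N right ≡ (f ⊛ deriv g) n
    right-sum = begin
      sumTo n right + fromℕ (N ∸ N) * (f N * g (N ∸ N))
        ≡⟨ cong (λ x → sumTo n right + fromℕ x * (f N * g x)) (ℕP.n∸n≡0 n) ⟩
      sumTo n right + 0ℚ * (f N * g 0)
        ≡⟨ cong (sumTo n right +_) (ℚP.*-zeroˡ (f N * g 0)) ⟩
      sumTo n right + 0ℚ
        ≡⟨ ℚP.+-identityʳ _ ⟩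
      sumTo n right
        ≡⟨ sumTo-cong≤ n (λ i i≤n → trans (cong (λ x → fromℕ x * (f i * g x)) (ℕP.+-∸-assoc 1 i≤n))
             (solve 3 (λ a b c → a :* (b :* c) := b :* (a :* c)) refl (fromℕ (suc (n ∸ i))) (f i) (g (suc (n ∸ i))))) ⟩
      (f ⊛ deriv g) n ∎

  deriv-pow : ∀ (f : Series) k n → deriv (pow f (suc k)) n ≡ fromℕ (suc k) * (pow f k ⊛ deriv f) n
  deriv-pow f zero    n = begin
    deriv (f ⊛ one) n                          ≡⟨ deriv-⊛ f one n ⟩
    (deriv f ⊛ one) n + (f ⊛ deriv one) n      ≡⟨ cong₂ _+_ (⊛-identityʳ (deriv f) n) deriv-one-vanishes ⟩
    deriv f n + 0ℚ                             ≡⟨ ℚP.+-identityʳ _ ⟩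
    deriv f n                                  ≡⟨ trans (ℚP.*-identityˡ _) (⊛-identityˡ (deriv f) n) ⟨
    fromℕ 1 * (one ⊛ deriv f) n                ∎
    where
    open ≡-Reasoning
    deriv-one-vanishes : (f ⊛ deriv one) n ≡ 0ℚ
    deriv-one-vanishes = sumTo-zero n (λ i _ →
      trans (cong (f i *_) (ℚP.*-zeroʳ (fromℕ (suc (n ∸ i))))) (ℚP.*-zeroʳ (f i)))
  deriv-pow f (suc k) n = begin
    deriv (f ⊛ pow f (suc k)) n
      ≡⟨ deriv-⊛ f (pow f (suc k)) n ⟩
    (deriv f ⊛ pow f (suc k)) n + (f ⊛ deriv (pow f (suc k))) n
      ≡⟨ cong₂ _+_ (⊛-comm (deriv f) (pow f (suc k)) n) (⊛-congʳ≤ n f (λ m _ → deriv-pow f k m)) ⟩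
    X + (f ⊛ (λ m → c * (pow f k ⊛ deriv f) m)) n
      ≡⟨ cong (X +_) (trans (⊛-scaleʳ f (pow f k ⊛ deriv f) c n) (cong (c *_) (sym (⊛-assoc f (pow f k) (deriv f) n)))) ⟩
    X + c * X
      ≡⟨ solve 2 (λ x y → x :+ y :* x := (con 1ℚ :+ y) :* x) refl X c ⟩
    (1ℚ + c) * X
      ≡⟨ cong (_* X) (fromℕ-+ 1 (suc k)) ⟨
    fromℕ (suc (suc k)) * X ∎
    where
    open ≡-Reasoning
    c = fromℕ (suc k)
    X = (pow f (suc k) ⊛ deriv f) n

  pow-+ : ∀ (f : Series) a b n → (pow f a ⊛ pow f b) n ≡ pow f (a ℕ.+ b) n
  pow-+ f zero    b n = ⊛-identityˡ (pow f b) n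
  pow-+ f (suc a) b n =
    trans (⊛-assoc f (pow f a) (pow f b) n) (⊛-congʳ≤ n f (λ m _ → pow-+ f a b m))

  pow-vanishes-below : ∀ (f : Series) → f 0 ≡ 0ℚ → ∀ k m → m < k → pow f k m ≡ 0ℚ
  pow-vanishes-below f f0≡0 (suc k) m m<1+k = sumTo-zero m term-vanishes
    where
    term-vanishes : ∀ i → i ≤ m → f i * pow f k (m ∸ i) ≡ 0ℚ
    term-vanishes zero    _ = trans (cong (_* pow f k m) f0≡0) (ℚP.*-zeroˡ (pow f k m))
    term-vanishes (suc i) i<m = trans (cong (f (suc i) *_) (pow-vanishes-below f f0≡0 k (m ∸ suc i) m-1-i<k))
                                      (ℚP.*-zeroʳ (f (suc i)))
      where
      m-1-i<k : m ∸ suc i < k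
      m-1-i<k = ℕP.≤-trans (ℕP.≤-reflexive (sym (ℕP.+-∸-assoc 1 i<m)))
                           (ℕP.≤-trans (ℕP.m∸n≤m m i) (ℕ.s≤s⁻¹ m<1+k))

  pow-⊛-expS : ∀ (f : Series) → f 0 ≡ 0ℚ → ∀ k n →
               (pow f k ⊛ expS f) n ≡ sumTo n (λ i → invFact i * pow f (k ℕ.+ i) n)
  pow-⊛-expS f f0≡0 k n = begin
    sumTo n (λ a → pow f k a * sumTo (n ∸ a) (λ i → invFact i * pow f i (n ∸ a)))
      ≡⟨ sumTo-cong≤ n (λ a a≤n → cong (pow f k a *_) (sumTo-extend (n ∸ a) n _ (ℕP.m∸n≤m n a)
           (λ i n-a<i _ → trans (cong (invFact i *_) (pow-vanishes-below f f0≡0 i (n ∸ a) n-a<i)) (ℚP.*-zeroʳ (invFact i))))) ⟩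
    sumTo n (λ a → pow f k a * sumTo n (λ i → invFact i * pow f i (n ∸ a)))
      ≡⟨ sumTo-cong n (λ a → *-distribˡ-sumTo n (pow f k a) (λ i → invFact i * pow f i (n ∸ a))) ⟩
    sumTo n (λ a → sumTo n (λ i → pow f k a * (invFact i * pow f i (n ∸ a))))
      ≡⟨ sumTo-comm n n (λ a i → pow f k a * (invFact i * pow f i (n ∸ a))) ⟩
    sumTo n (λ i → sumTo n (λ a → pow f k a * (invFact i * pow f i (n ∸ a))))
      ≡⟨ sumTo-cong n (λ i → trans (sumTo-cong n (λ a → solve 3 (λ x y z → x :* (y :* z) := y :* (x :* z)) refl
                                                            (pow f k a) (invFact i) (pow f i (n ∸ a))))
            (sym (*-distribˡ-sumTo n (invFact i) (λ a → pow f k a * pow f i (n ∸ a))))) ⟩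
    sumTo n (λ i → invFact i * (pow f k ⊛ pow f i) n)
      ≡⟨ sumTo-cong n (λ i → cong (invFact i *_) (pow-+ f k i n)) ⟩
    sumTo n (λ i → invFact i * pow f (k ℕ.+ i) n) ∎
    where open ≡-Reasoning


module Binomial where

  open import Data.Nat using (_+_; _*_; _∸_; _!)
  open import Data.Nat.Properties using (m≤m+n; m+n∸m≡n; _!*_!≢0)
  open import Data.Nat.Combinatorics using (_C_; nCk≡n!/k![n-k]!; k![n∸k]!∣n!)
  open import Data.Nat.DivMod using (_/_; m/n*n≡m)
  open import Relation.Binary.PropositionalEquality

  [k+i]Ck*k!*i!≡[k+i]! : ∀ k i → ((k + i) C k) * (k ! * i !) ≡ (k + i) !
  [k+i]Ck*k!*i!≡[k+i]! k i = begin
    ((k + i) C k) * (k ! * i !)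
      ≡⟨ cong (λ j → ((k + i) C k) * (k ! * j !)) (m+n∸m≡n k i) ⟨
    ((k + i) C k) * (k ! * (k + i ∸ k) !)
      ≡⟨ cong (_* (k ! * (k + i ∸ k) !)) (nCk≡n!/k![n-k]! (m≤m+n k i)) ⟩
    ((k + i) ! / (k ! * (k + i ∸ k) !)) * (k ! * (k + i ∸ k) !)
      ≡⟨ m/n*n≡m (k![n∸k]!∣n! (m≤m+n k i)) ⟩
    (k + i) ! ∎
    where
    open ≡-Reasoning
    instance _ = k !* (k + i ∸ k) !≢0


module ForestRecurrence
  (F : ℕ → ℕ → ℕ)
  (F-0-0 : F 0 0 ≡ 1)
  (F-suc-0 : ∀ n → F (suc n) 0 ≡ 0)
  (F-vanishes : ∀ n j → n < j → F n j ≡ 0)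
  (F-suc-suc : ∀ n k → F (suc n) (suc k) ≡
                 suc k ℕ.* F n (suc k) ℕ.+ FiniteSum.sumℕTo n (λ j → (j C k) ℕ.* F n j))
  where

  open import Data.Nat using (zero; _≤_; z≤n; s≤s; _!)
  open import Data.Nat.Combinatorics using (k>n⇒nCk≡0)
  import Data.Nat.Properties as ℕP
  open import Data.Rational using (ℚ; 1ℚ; _+_; _*_)
  import Data.Rational.Properties as ℚP
  open import Data.Rational.Solver using (module +-*-Solver)
  open import Data.Product using (_,_)
  open import Data.Sum using (inj₁; inj₂)
  open import Relation.Binary.PropositionalEquality
  open NatCast
  open FiniteSum
  open PowerSeries
  open Binomial
  open +-*-Solver

  T : Series
  T = egf (λ n → F n 1)

  forestEgf : ℕ → Series
  forestEgf k n = fromℕ (F n k) * invFact n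

  scaledForestEgf : ℕ → Series
  scaledForestEgf k n = fromℕ (k !) * forestEgf k n

  T≡forestEgf₁ : ∀ n → T n ≡ forestEgf 1 n
  T≡forestEgf₁ = egf≡fromℕ*invFact (λ n → F n 1)

  T-0 : T 0 ≡ 0ℚ
  T-0 = trans (T≡forestEgf₁ 0) (cong (λ x → fromℕ x * invFact 0) (F-vanishes 0 1 (s≤s z≤n)))

  deriv-T : ∀ m → deriv T m ≡ fromℕ (F (suc m) 1) * invFact m
  deriv-T m = begin
    fromℕ (suc m) * T (suc m)
      ≡⟨ cong (fromℕ (suc m) *_) (T≡forestEgf₁ (suc m)) ⟩
    fromℕ (suc m) * (fromℕ (F (suc m) 1) * invFact (suc m))
      ≡⟨ solve 3 (λ a b c → a :* (b :* c) := b :* (a :* c)) refl (fromℕ (suc m)) (fromℕ (F (suc m) 1)) (invFact (suc m)) ⟩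
    fromℕ (F (suc m) 1) * (fromℕ (suc m) * invFact (suc m))
      ≡⟨ cong (fromℕ (F (suc m) 1) *_) (fromℕ[1+n]*invFact[1+n]≡invFact[n] m) ⟩
    fromℕ (F (suc m) 1) * invFact m ∎
    where open ≡-Reasoning

  PowCoeffs : ℕ → Set
  PowCoeffs n = ∀ k → pow T k n ≡ scaledForestEgf k n

  PowCoeffsUpTo : ℕ → Set
  PowCoeffsUpTo n = ∀ m → m ≤ n → PowCoeffs m

  powCoeffs-0 : PowCoeffs 0
  powCoeffs-0 zero    rewrite F-0-0 = refl
  powCoeffs-0 (suc k) rewrite T-0 | F-vanishes 0 (suc k) (s≤s z≤n) =
    trans (ℚP.*-zeroˡ (pow T k 0)) (sym (ℚP.*-zeroʳ (fromℕ (suc k !))))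

  invFact*pow≡forestEgf : ∀ {m} → PowCoeffs m → ∀ k → invFact k * pow T k m ≡ forestEgf k m
  invFact*pow≡forestEgf {m} coeffs k = begin
    invFact k * pow T k m                      ≡⟨ cong (invFact k *_) (coeffs k) ⟩
    invFact k * (fromℕ (k !) * forestEgf k m)  ≡⟨ ℚP.*-assoc (invFact k) _ _ ⟨
    invFact k * fromℕ (k !) * forestEgf k m    ≡⟨ cong (_* forestEgf k m) (trans (ℚP.*-comm (invFact k) _)
                                                                                (fromℕ[n!]*invFact[n]≡1 k)) ⟩
    1ℚ * forestEgf k m                         ≡⟨ ℚP.*-identityˡ _ ⟩
    forestEgf k m                              ∎
    where open ≡-Reasoning

  ode-at : ∀ m → PowCoeffs m → deriv T m ≡ (T ⊕ expS T) m
  ode-at m coeffs = begin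
    deriv T m
      ≡⟨ deriv-T m ⟩
    fromℕ (F (suc m) 1) * invFact m
      ≡⟨ cong (λ x → fromℕ x * invFact m) (F-suc-suc m 0) ⟩
    fromℕ (1 ℕ.* F m 1 ℕ.+ sumℕTo m (λ j → 1 ℕ.* F m j)) * invFact m
      ≡⟨ cong (_* invFact m) (trans (fromℕ-+ (1 ℕ.* F m 1) _) (cong₂ _+_ (cong fromℕ (ℕP.*-identityˡ (F m 1)))
           (trans (fromℕ-sumℕTo m (λ j → 1 ℕ.* F m j)) (sumTo-cong m (λ j → cong fromℕ (ℕP.*-identityˡ (F m j))))))) ⟩
    (fromℕ (F m 1) + sumTo m (λ j → fromℕ (F m j))) * invFact m
      ≡⟨ ℚP.*-distribʳ-+ (invFact m) (fromℕ (F m 1)) _ ⟩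
    forestEgf 1 m + sumTo m (λ j → fromℕ (F m j)) * invFact m
      ≡⟨ cong₂ _+_ (sym (T≡forestEgf₁ m))
           (trans (*-distribʳ-sumTo m (invFact m) (λ j → fromℕ (F m j)))
                  (sumTo-cong m (λ k → sym (invFact*pow≡forestEgf coeffs k)))) ⟩
    T m + expS T m ∎
    where open ≡-Reasoning

  binomialSum : ∀ n k → fromℕ (sumℕTo n (λ j → (j C k) ℕ.* F n j)) * (fromℕ (suc k !) * invFact n)
                      ≡ fromℕ (suc k) * sumTo n (λ i → invFact i * scaledForestEgf (k ℕ.+ i) n)
  binomialSum n k = begin
    fromℕ (sumℕTo n (λ j → (j C k) ℕ.* F n j)) * c
      ≡⟨ cong (_* c) (fromℕ-sumℕTo n (λ j → (j C k) ℕ.* F n j)) ⟩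
    sumTo n (λ j → fromℕ ((j C k) ℕ.* F n j)) * c
      ≡⟨ *-distribʳ-sumTo n c (λ j → fromℕ ((j C k) ℕ.* F n j)) ⟩
    sumTo n term
      ≡⟨ sumTo-extend n (k ℕ.+ n) term (ℕP.m≤n+m n k) (λ j n<j _ →
           term-vanishes (trans (cong ((j C k) ℕ.*_) (F-vanishes n j n<j)) (ℕP.*-zeroʳ (j C k)))) ⟩
    sumTo (k ℕ.+ n) term
      ≡⟨ sumTo-dropInitialZeros k n term (λ j j<k → term-vanishes (cong (ℕ._* F n j) (k>n⇒nCk≡0 j<k))) ⟩
    sumTo n (λ i → term (k ℕ.+ i))
      ≡⟨ sumTo-cong n shifted-term ⟩
    sumTo n (λ i → fromℕ (suc k) * (invFact i * scaledForestEgf (k ℕ.+ i) n))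
      ≡⟨ *-distribˡ-sumTo n (fromℕ (suc k)) (λ i → invFact i * scaledForestEgf (k ℕ.+ i) n) ⟨
    fromℕ (suc k) * sumTo n (λ i → invFact i * scaledForestEgf (k ℕ.+ i) n) ∎
    where
    open ≡-Reasoning
    c = fromℕ (suc k !) * invFact n
    term : ℕ → ℚ
    term j = fromℕ ((j C k) ℕ.* F n j) * c
    term-vanishes : ∀ {j} → (j C k) ℕ.* F n j ≡ 0 → term j ≡ 0ℚ
    term-vanishes prod≡0 = trans (cong (λ x → fromℕ x * c) prod≡0) (ℚP.*-zeroˡ c)
    shifted-term : ∀ i → term (k ℕ.+ i) ≡ fromℕ (suc k) * (invFact i * scaledForestEgf (k ℕ.+ i) n)
    shifted-term i = sym (begin
      fromℕ (suc k) * (invFact i * (fromℕ ((k ℕ.+ i) !) * (fromℕ (F n (k ℕ.+ i)) * invFact n)))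
        ≡⟨ cong (λ x → fromℕ (suc k) * (invFact i * (x * (fromℕ (F n (k ℕ.+ i)) * invFact n))))
             (trans (cong fromℕ (sym ([k+i]Ck*k!*i!≡[k+i]! k i)))
                    (trans (fromℕ-* B _) (cong (fromℕ B *_) (fromℕ-* (k !) (i !))))) ⟩
      fromℕ (suc k) * (invFact i * ((fromℕ B * (fromℕ (k !) * fromℕ (i !))) * (fromℕ (F n (k ℕ.+ i)) * invFact n)))
        ≡⟨ solve 7 (λ sk fi b kf if f fn → sk :* (fi :* ((b :* (kf :* if)) :* (f :* fn)))
                                          := (if :* fi) :* (b :* f :* (sk :* kf :* fn))) refl
             (fromℕ (suc k)) (invFact i) (fromℕ B) (fromℕ (k !)) (fromℕ (i !)) (fromℕ (F n (k ℕ.+ i))) (invFact n) ⟩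
      (fromℕ (i !) * invFact i) * (fromℕ B * fromℕ (F n (k ℕ.+ i)) * (fromℕ (suc k) * fromℕ (k !) * invFact n))
        ≡⟨ cong (_* (fromℕ B * fromℕ (F n (k ℕ.+ i)) * (fromℕ (suc k) * fromℕ (k !) * invFact n)))
                (fromℕ[n!]*invFact[n]≡1 i) ⟩
      1ℚ * (fromℕ B * fromℕ (F n (k ℕ.+ i)) * (fromℕ (suc k) * fromℕ (k !) * invFact n))
        ≡⟨ ℚP.*-identityˡ _ ⟩
      fromℕ B * fromℕ (F n (k ℕ.+ i)) * (fromℕ (suc k) * fromℕ (k !) * invFact n)
        ≡⟨ cong₂ (λ x y → x * (y * invFact n)) (sym (fromℕ-* B (F n (k ℕ.+ i)))) (sym (fromℕ-* (suc k) (k !))) ⟩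
      term (k ℕ.+ i) ∎)
      where B = (k ℕ.+ i) C k

  scaledRecurrence : ∀ n k →
    fromℕ (suc n) * scaledForestEgf (suc k) (suc n)
      ≡ fromℕ (suc k) * (scaledForestEgf (suc k) n + sumTo n (λ i → invFact i * scaledForestEgf (k ℕ.+ i) n))
  scaledRecurrence n k = begin
    fromℕ (suc n) * (fromℕ (suc k !) * (fromℕ (F (suc n) (suc k)) * invFact (suc n)))
      ≡⟨ solve 4 (λ a b c d → a :* (c :* (b :* d)) := b :* c :* (a :* d)) refl
           (fromℕ (suc n)) (fromℕ (F (suc n) (suc k))) (fromℕ (suc k !)) (invFact (suc n)) ⟩
    fromℕ (F (suc n) (suc k)) * fromℕ (suc k !) * (fromℕ (suc n) * invFact (suc n))
      ≡⟨ cong₂ (λ x y → fromℕ x * fromℕ (suc k !) * y) (F-suc-suc n k) (fromℕ[1+n]*invFact[1+n]≡invFact[n] n) ⟩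
    fromℕ (suc k ℕ.* F n (suc k) ℕ.+ S) * fromℕ (suc k !) * invFact n
      ≡⟨ cong (λ x → x * fromℕ (suc k !) * invFact n)
           (trans (fromℕ-+ (suc k ℕ.* F n (suc k)) S) (cong (_+ fromℕ S) (fromℕ-* (suc k) (F n (suc k))))) ⟩
    (fromℕ (suc k) * fromℕ (F n (suc k)) + fromℕ S) * fromℕ (suc k !) * invFact n
      ≡⟨ solve 5 (λ a b s c d → (a :* b :+ s) :* c :* d := a :* (c :* (b :* d)) :+ s :* (c :* d)) refl
           (fromℕ (suc k)) (fromℕ (F n (suc k))) (fromℕ S) (fromℕ (suc k !)) (invFact n) ⟩
    fromℕ (suc k) * scaledForestEgf (suc k) n + fromℕ S * (fromℕ (suc k !) * invFact n)
      ≡⟨ cong (fromℕ (suc k) * scaledForestEgf (suc k) n +_) (binomialSum n k) ⟩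
    fromℕ (suc k) * scaledForestEgf (suc k) n + fromℕ (suc k) * sumTo n (λ i → invFact i * scaledForestEgf (k ℕ.+ i) n)
      ≡⟨ ℚP.*-distribˡ-+ (fromℕ (suc k)) _ _ ⟨
    fromℕ (suc k) * (scaledForestEgf (suc k) n + sumTo n (λ i → invFact i * scaledForestEgf (k ℕ.+ i) n)) ∎
    where
    open ≡-Reasoning
    S = sumℕTo n (λ j → (j C k) ℕ.* F n j)

  deriv-pow-T : ∀ n → PowCoeffsUpTo n → ∀ k →
    deriv (pow T (suc k)) n
      ≡ fromℕ (suc k) * (scaledForestEgf (suc k) n + sumTo n (λ i → invFact i * scaledForestEgf (k ℕ.+ i) n))
  deriv-pow-T n coeffs k = begin
    deriv (pow T (suc k)) n
      ≡⟨ deriv-pow T k n ⟩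
    fromℕ (suc k) * (pow T k ⊛ deriv T) n
      ≡⟨ cong (fromℕ (suc k) *_) (⊛-congʳ≤ n (pow T k) (λ m m≤n → ode-at m (coeffs m m≤n))) ⟩
    fromℕ (suc k) * (pow T k ⊛ (T ⊕ expS T)) n
      ≡⟨ cong (fromℕ (suc k) *_) (⊛-distribˡ-⊕ (pow T k) T (expS T) n) ⟩
    fromℕ (suc k) * ((pow T k ⊛ T) n + (pow T k ⊛ expS T) n)
      ≡⟨ cong (λ x → fromℕ (suc k) * x) (cong₂ _+_ (⊛-comm (pow T k) T n) (pow-⊛-expS T T-0 k n)) ⟩
    fromℕ (suc k) * (pow T (suc k) n + sumTo n (λ i → invFact i * pow T (k ℕ.+ i) n))
      ≡⟨ cong (λ x → fromℕ (suc k) * x) (cong₂ _+_ (coeffs-n (suc k))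
           (sumTo-cong n (λ i → cong (invFact i *_) (coeffs-n (k ℕ.+ i))))) ⟩
    fromℕ (suc k) * (scaledForestEgf (suc k) n + sumTo n (λ i → invFact i * scaledForestEgf (k ℕ.+ i) n)) ∎
    where
    open ≡-Reasoning
    coeffs-n = coeffs n ℕP.≤-refl

  powCoeffs-suc : ∀ n → PowCoeffsUpTo n → PowCoeffs (suc n)
  powCoeffs-suc n coeffs zero rewrite F-suc-0 n =
    sym (trans (cong (fromℕ 1 *_) (ℚP.*-zeroˡ (invFact (suc n)))) (ℚP.*-zeroʳ (fromℕ 1)))
  powCoeffs-suc n coeffs (suc k) =
    *-cancelˡ-fromℕ-suc n (trans (deriv-pow-T n coeffs k) (sym (scaledRecurrence n k)))

  powCoeffsUpTo : ∀ n → PowCoeffsUpTo n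
  powCoeffsUpTo zero    .zero z≤n = powCoeffs-0
  powCoeffsUpTo (suc n) m m≤1+n with ℕP.m≤n⇒m<n∨m≡n m≤1+n
  ... | inj₁ (s≤s m≤n) = powCoeffsUpTo n m m≤n
  ... | inj₂ refl      = powCoeffs-suc n (powCoeffsUpTo n)

  ode : T 0 ≡ 0ℚ × (∀ n → deriv T n ≡ (T ⊕ expS T) n)
  ode = T-0 , (λ n → ode-at n (powCoeffsUpTo n n ℕP.≤-refl))


module ListSum where

  open import Data.Nat using (ℕ; suc; zero; _+_; _*_; _≤_; z≤n; s≤s; _≡ᵇ_)
  import Data.Nat.Properties as ℕP
  open import Data.Nat.Solver using (module +-*-Solver)
  open import Data.Bool using (Bool; true; false; _∧_; T)
  open import Data.Sum using (inj₁; inj₂)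
  open import Relation.Nullary using (contradiction)
  open import Data.Fin using (Fin)
  import Data.Fin as Fin
  open import Data.List using (List; []; _∷_; _++_; map; concatMap; filterᵇ; length; tabulate; allFin)
  open import Function using (_∘_)
  open import Relation.Binary.PropositionalEquality
  open FiniteSum using (sumℕTo; sumℕTo-cong)

  private variable A B : Set

  𝟙 : Bool → ℕ
  𝟙 true  = 1
  𝟙 false = 0

  𝟙-∧ : ∀ a b → 𝟙 (a ∧ b) ≡ 𝟙 a * 𝟙 b
  𝟙-∧ true  b = sym (ℕP.+-identityʳ (𝟙 b))
  𝟙-∧ false b = refl

  sumOver : (A → ℕ) → List A → ℕ
  sumOver φ []       = 0
  sumOver φ (x ∷ xs) = φ x + sumOver φ xs

  length-filterᵇ : ∀ (f : A → Bool) xs → length (filterᵇ f xs) ≡ sumOver (𝟙 ∘ f) xs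
  length-filterᵇ f []       = refl
  length-filterᵇ f (x ∷ xs) with f x
  ... | true  = cong suc (length-filterᵇ f xs)
  ... | false = length-filterᵇ f xs

  sumOver-cong : ∀ {φ ψ : A → ℕ} xs → (∀ x → φ x ≡ ψ x) → sumOver φ xs ≡ sumOver ψ xs
  sumOver-cong []       φ≡ψ = refl
  sumOver-cong (x ∷ xs) φ≡ψ = cong₂ _+_ (φ≡ψ x) (sumOver-cong xs φ≡ψ)

  sumOver-zero : ∀ {φ : A → ℕ} xs → (∀ x → φ x ≡ 0) → sumOver φ xs ≡ 0
  sumOver-zero []       φ≡0 = refl
  sumOver-zero (x ∷ xs) φ≡0 = cong₂ _+_ (φ≡0 x) (sumOver-zero xs φ≡0)

  sumOver-++ : ∀ (φ : A → ℕ) xs ys → sumOver φ (xs ++ ys) ≡ sumOver φ xs + sumOver φ ys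
  sumOver-++ φ []       ys = refl
  sumOver-++ φ (x ∷ xs) ys = trans (cong (φ x +_) (sumOver-++ φ xs ys)) (sym (ℕP.+-assoc (φ x) _ _))

  sumOver-map : ∀ (φ : B → ℕ) (g : A → B) xs → sumOver φ (map g xs) ≡ sumOver (φ ∘ g) xs
  sumOver-map φ g []       = refl
  sumOver-map φ g (x ∷ xs) = cong (φ (g x) +_) (sumOver-map φ g xs)

  sumOver-concatMap : ∀ (φ : B → ℕ) (g : A → List B) xs →
                      sumOver φ (concatMap g xs) ≡ sumOver (λ x → sumOver φ (g x)) xs
  sumOver-concatMap φ g []       = refl
  sumOver-concatMap φ g (x ∷ xs) =
    trans (sumOver-++ φ (g x) (concatMap g xs)) (cong (sumOver φ (g x) +_) (sumOver-concatMap φ g xs))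

  sumOver-+ : ∀ (φ ψ : A → ℕ) xs → sumOver (λ x → φ x + ψ x) xs ≡ sumOver φ xs + sumOver ψ xs
  sumOver-+ φ ψ []       = refl
  sumOver-+ φ ψ (x ∷ xs) = trans (cong (φ x + ψ x +_) (sumOver-+ φ ψ xs))
    (solve 4 (λ a b c d → (a :+ b) :+ (c :+ d) := (a :+ c) :+ (b :+ d)) refl
      (φ x) (ψ x) (sumOver φ xs) (sumOver ψ xs))
    where open +-*-Solver

  *-distribˡ-sumOver : ∀ c (φ : A → ℕ) xs → c * sumOver φ xs ≡ sumOver (λ x → c * φ x) xs
  *-distribˡ-sumOver c φ []       = ℕP.*-zeroʳ c
  *-distribˡ-sumOver c φ (x ∷ xs) =
    trans (ℕP.*-distribˡ-+ c (φ x) (sumOver φ xs)) (cong (c * φ x +_) (*-distribˡ-sumOver c φ xs))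

  sumOver-comm : ∀ (h : A → B → ℕ) xs ys →
                 sumOver (λ x → sumOver (h x) ys) xs ≡ sumOver (λ y → sumOver (λ x → h x y) xs) ys
  sumOver-comm h []       ys = sym (sumOver-zero ys (λ _ → refl))
  sumOver-comm h (x ∷ xs) ys = trans (cong (sumOver (h x) ys +_) (sumOver-comm h xs ys))
    (sym (sumOver-+ (h x) (λ y → sumOver (λ x → h x y) xs) ys))

  sumOver-tabulate : ∀ n (φ : A → ℕ) (f : Fin n → A) → sumOver φ (tabulate f) ≡ sumOver (φ ∘ f) (allFin n)
  sumOver-tabulate zero    φ f = refl
  sumOver-tabulate (suc n) φ f = cong (φ (f Fin.zero) +_)
    (trans (sumOver-tabulate n φ (f ∘ Fin.suc)) (sym (sumOver-tabulate n (φ ∘ f) Fin.suc)))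


  ≡ᵇ-false : ∀ {m n} → m ≢ n → (m ≡ᵇ n) ≡ false
  ≡ᵇ-false {m} {n} m≢n with m ≡ᵇ n in eq
  ... | false = refl
  ... | true  = contradiction (ℕP.≡ᵇ⇒≡ m n (subst T (sym eq) _)) m≢n

  ≡ᵇ-refl : ∀ n → (n ≡ᵇ n) ≡ true
  ≡ᵇ-refl zero    = refl
  ≡ᵇ-refl (suc n) = ≡ᵇ-refl n

  sumℕTo-indicator : ∀ n {r} (h : ℕ → ℕ) → r ≤ n → sumℕTo n (λ j → 𝟙 (r ≡ᵇ j) * h j) ≡ h r
  sumℕTo-indicator zero    h z≤n = ℕP.+-identityʳ (h 0)
  sumℕTo-indicator (suc n) {r} h r≤1+n with ℕP.m≤n⇒m<n∨m≡n r≤1+n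
  ... | inj₁ (s≤s r≤n) rewrite ≡ᵇ-false (ℕP.<⇒≢ (s≤s r≤n)) = trans (ℕP.+-identityʳ _) (sumℕTo-indicator n h r≤n)
  ... | inj₂ refl rewrite ≡ᵇ-refl n =
    trans (cong (_+ (h (suc n) + 0))
                (sumℕTo-zero n (λ j j≤n → cong (λ b → 𝟙 b * h j) (≡ᵇ-false (ℕP.>⇒≢ (s≤s j≤n))))))
          (ℕP.+-identityʳ (h (suc n)))
    where
    sumℕTo-zero : ∀ n {g : ℕ → ℕ} → (∀ j → j ≤ n → g j ≡ 0) → sumℕTo n g ≡ 0
    sumℕTo-zero zero    g≡0 = g≡0 0 z≤n
    sumℕTo-zero (suc n) g≡0 =
      cong₂ _+_ (sumℕTo-zero n (λ j j≤n → g≡0 j (ℕP.m≤n⇒m≤1+n j≤n))) (g≡0 (suc n) ℕP.≤-refl)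

  sumOver-sumℕTo : ∀ {A : Set} n (h : A → ℕ → ℕ) xs →
                   sumOver (λ x → sumℕTo n (h x)) xs ≡ sumℕTo n (λ j → sumOver (λ x → h x j) xs)
  sumOver-sumℕTo zero    h xs = refl
  sumOver-sumℕTo (suc n) h xs = trans (sumOver-+ (λ x → sumℕTo n (h x)) (λ x → h x (suc n)) xs)
    (cong (_+ sumOver (λ x → h x (suc n)) xs) (sumOver-sumℕTo n h xs))

  sumOver-groupBy : ∀ {A : Set} n (key : A → ℕ) (f : ℕ → ℕ) (g : A → ℕ) xs → (∀ x → key x ≤ n) →
                    sumOver (λ x → f (key x) * g x) xs
                    ≡ sumℕTo n (λ j → f j * sumOver (λ x → 𝟙 (key x ≡ᵇ j) * g x) xs)
  sumOver-groupBy n key f g xs key≤n = begin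
    sumOver (λ x → f (key x) * g x) xs
      ≡⟨ sumOver-cong xs (λ x → sym (sumℕTo-indicator n (λ j → f j * g x) (key≤n x))) ⟩
    sumOver (λ x → sumℕTo n (λ j → 𝟙 (key x ≡ᵇ j) * (f j * g x))) xs
      ≡⟨ sumOver-sumℕTo n (λ x j → 𝟙 (key x ≡ᵇ j) * (f j * g x)) xs ⟩
    sumℕTo n (λ j → sumOver (λ x → 𝟙 (key x ≡ᵇ j) * (f j * g x)) xs)
      ≡⟨ sumℕTo-cong n (λ j → trans (sumOver-cong xs (λ x → x∙yz≈y∙xz (𝟙 (key x ≡ᵇ j)) (f j) (g x)))
                                     (sym (*-distribˡ-sumOver (f j) (λ x → 𝟙 (key x ≡ᵇ j) * g x) xs))) ⟩
    sumℕTo n (λ j → f j * sumOver (λ x → 𝟙 (key x ≡ᵇ j) * g x) xs) ∎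
    where
    open ≡-Reasoning
    open import Algebra.Properties.CommutativeSemigroup ℕP.*-commutativeSemigroup using (x∙yz≈y∙xz)


module BoolListAction where

  open import Data.Bool using (Bool; true)
  open import Data.Bool.ListAction using (any; all)
  import Data.Bool.Properties as BoolP
  open import Data.List using (List; []; _∷_)
  open import Data.List.Relation.Unary.Any using (here; there)
  open import Data.List.Relation.Unary.Any.Properties using (any⁺; any⁻)
  open import Data.List.Membership.Propositional using (_∈_; find; lose)
  open import Data.Product using (∃; _×_; _,_)
  open import Function using (Equivalence)
  open import Relation.Binary.PropositionalEquality
  open Equivalence

  private variable A : Set

  any-true⁺ : ∀ (f : A → Bool) {x xs} → x ∈ xs → f x ≡ true → any f xs ≡ true
  any-true⁺ f x∈xs fx = to BoolP.T-≡ (any⁺ f (lose x∈xs (from BoolP.T-≡ fx)))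

  any-true⁻ : ∀ (f : A → Bool) xs → any f xs ≡ true → ∃ λ x → x ∈ xs × f x ≡ true
  any-true⁻ f xs h with x , x∈xs , fx ← find (any⁻ f xs (from BoolP.T-≡ h)) = x , x∈xs , to BoolP.T-≡ fx

  all-true⁺ : ∀ (f : A → Bool) xs → (∀ x → x ∈ xs → f x ≡ true) → all f xs ≡ true
  all-true⁺ f []       h = refl
  all-true⁺ f (y ∷ xs) h rewrite h y (here refl) = all-true⁺ f xs (λ x x∈xs → h x (there x∈xs))

  all-true⁻ : ∀ (f : A → Bool) xs → all f xs ≡ true → ∀ {x} → x ∈ xs → f x ≡ true
  all-true⁻ f (y ∷ xs) h (here refl)  with f y
  ... | true = refl
  all-true⁻ f (y ∷ xs) h (there x∈xs) with f y
  ... | true = all-true⁻ f xs h x∈xs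


module Ancestry where

  open import Data.Nat as ℕ using (ℕ; zero; suc; _+_; _*_; _∸_; _≤_)
  import Data.Nat.Properties as ℕP
  open import Data.Fin using (Fin; toℕ)
  import Data.Fin.Properties as FinP
  open import Data.Maybe using (just; nothing; _>>=_)
  open import Data.Vec using (lookup)
  open import Data.Product using (Σ; ∃; _,_; proj₁; proj₂)
  open import Data.Empty using (⊥; ⊥-elim)
  open import Relation.Binary.PropositionalEquality

  Ancestor : ∀ {n} → ParentMap n → Fin n → Fin n → Set
  Ancestor p u v = ∃ λ k → up p (suc k) v ≡ just u

  Acyclic : ∀ {n} → ParentMap n → Set
  Acyclic p = ∀ v → ∃ λ k → up p k v ≡ nothing

  just≢nothing : ∀ {A : Set} {x : A} → just x ≢ nothing
  just≢nothing ()

  module _ {n : ℕ} (p : ParentMap n) where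

    up-+ : ∀ d m v → up p (d + m) v ≡ (up p m v >>= up p d)
    up-+ zero    m v with up p m v
    ... | just _  = refl
    ... | nothing = refl
    up-+ (suc d) m v with up p m v | up-+ d m v
    ... | just w  | eq = cong (_>>= lookup p) eq
    ... | nothing | eq = cong (_>>= lookup p) eq

    up-suc : ∀ k v → up p (suc k) v ≡ (lookup p v >>= up p k)
    up-suc k v = trans (cong (λ x → up p x v) (ℕP.+-comm 1 k)) (up-+ k 1 v)

    up-nothing-mono : ∀ {m k} v → m ≤ k → up p m v ≡ nothing → up p k v ≡ nothing
    up-nothing-mono {m} {k} v m≤k eq = begin
      up p k v                        ≡⟨ cong (λ x → up p x v) (ℕP.m∸n+n≡m m≤k) ⟨
      up p (k ∸ m + m) v              ≡⟨ up-+ (k ∸ m) m v ⟩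
      (up p m v >>= up p (k ∸ m))     ≡⟨ cong (_>>= up p (k ∸ m)) eq ⟩
      nothing                         ∎
      where open ≡-Reasoning

    up-cycle : ∀ c y → up p c y ≡ just y → ∀ m → up p (m * c) y ≡ just y
    up-cycle c y eq zero    = refl
    up-cycle c y eq (suc m) =
      trans (up-+ c (m * c) y) (trans (cong (_>>= up p c) (up-cycle c y eq m)) eq)

    acyclic⇒no-reachable-cycle : Acyclic p → ∀ a v y c → up p a v ≡ just y → up p (suc c) y ≡ just y → ⊥
    acyclic⇒no-reachable-cycle acyclic a v y c reach cycle with k , escape ← acyclic v =
      just≢nothing (trans (sym loop) (up-nothing-mono v k≤ escape))
      where
      loop : up p (k * suc c + a) v ≡ just y
      loop = trans (up-+ (k * suc c) a v) (trans (cong (_>>= up p (k * suc c)) reach) (up-cycle (suc c) y cycle k))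
      k≤ : k ≤ k * suc c + a
      k≤ = ℕP.≤-trans (ℕP.m≤m*n k (suc c)) (ℕP.m≤m+n (k * suc c) a)

    ancestor-irrefl : Acyclic p → ∀ u → Ancestor p u u → ⊥
    ancestor-irrefl acyclic u (k , eq) = acyclic⇒no-reachable-cycle acyclic 0 u u k refl eq

    ancestor-trans : ∀ {u v w} → Ancestor p u v → Ancestor p v w → Ancestor p u w
    ancestor-trans {w = w} (a , u-v) (b , v-w) =
      a + suc b , trans (up-+ (suc a) (suc b) w) (trans (cong (_>>= up p (suc a)) v-w) u-v)

    -- a walk of n steps visits n + 1 vertices, so by pigeonhole it would contain a cycle
    acyclic⇒up-n≡nothing : Acyclic p → ∀ v → up p n v ≡ nothing
    acyclic⇒up-n≡nothing acyclic v with up p n v in up-n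
    ... | nothing = refl
    ... | just x  = ⊥-elim (acyclic⇒no-reachable-cycle acyclic (toℕ i) v (visit i) (ℕ.pred d) (visit-reached i) cycle)
      where
      walk : (i : Fin (suc n)) → Σ (Fin n) (λ y → up p (toℕ i) v ≡ just y)
      walk i with up p (toℕ i) v in eq
      ... | just y  = y , refl
      ... | nothing = ⊥-elim (just≢nothing (trans (sym up-n) (up-nothing-mono v (ℕ.s≤s⁻¹ (FinP.toℕ<n i)) eq)))
      visit : Fin (suc n) → Fin n
      visit i = proj₁ (walk i)
      visit-reached : ∀ i → up p (toℕ i) v ≡ just (visit i)
      visit-reached i = proj₂ (walk i)
      repeat = FinP.pigeonhole (ℕP.n<1+n n) visit
      i = proj₁ repeat
      j = proj₁ (proj₂ repeat)
      i<j = proj₁ (proj₂ (proj₂ repeat))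
      d = toℕ j ∸ toℕ i
      cycle : up p (suc (ℕ.pred d)) (visit i) ≡ just (visit i)
      cycle = begin
        up p (suc (ℕ.pred d)) (visit i)  ≡⟨ cong (λ z → up p z (visit i))
                                                   (ℕP.suc-pred d {{ℕ.>-nonZero (ℕP.m<n⇒0<n∸m i<j)}}) ⟩
        up p d (visit i)                 ≡⟨ cong (_>>= up p d) (visit-reached i) ⟨
        (up p (toℕ i) v >>= up p d)      ≡⟨ up-+ d (toℕ i) v ⟨
        up p (d + toℕ i) v               ≡⟨ cong (λ z → up p z v) (ℕP.m∸n+n≡m (ℕP.<⇒≤ i<j)) ⟩
        up p (toℕ j) v                   ≡⟨ visit-reached j ⟩
        just (visit j)                   ≡⟨ cong just (proj₂ (proj₂ (proj₂ repeat))) ⟨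
        just (visit i)                   ∎
        where open ≡-Reasoning


module S₀Patterns where

  open import Data.Nat using (ℕ; _<_; _≤_; z≤n; s≤s; _<ᵇ_)
  open import Data.Nat.Properties using (≤-refl; <⇒≤; <-trans; <-cmp)
  open import Data.Bool using (Bool; true; false; T)
  open import Data.Bool.Properties using (T-≡; T-∧)
  open import Data.List using ([]; _∷_)
  open import Data.List.Relation.Unary.Any using (here; there)
  open import Data.List.Membership.Propositional using (_∈_)
  open import Data.Product using (_×_; _,_; proj₁; proj₂; ∃-syntax)
  open import Data.Empty using (⊥-elim)
  open import Function using (Equivalence)
  open import Relation.Nullary using (¬_)
  open import Relation.Binary using (tri<; tri≈; tri>)
  open import Relation.Binary.PropositionalEquality
  open Equivalence

  <ᵇ-true : ∀ {a b} → a < b → (a <ᵇ b) ≡ true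
  <ᵇ-true (s≤s z≤n)       = refl
  <ᵇ-true (s≤s (s≤s a<b)) = <ᵇ-true (s≤s a<b)

  <ᵇ-false : ∀ {a b} → b ≤ a → (a <ᵇ b) ≡ false
  <ᵇ-false z≤n       = refl
  <ᵇ-false (s≤s b≤a) = <ᵇ-false b≤a

  <ᵇ-irrefl : ∀ a → (a <ᵇ a) ≡ false
  <ᵇ-irrefl a = <ᵇ-false {a} ≤-refl

  ==B-refl : ∀ u → (u ==B u) ≡ true
  ==B-refl true  = refl
  ==B-refl false = refl

  ==B-sound : ∀ {u v} → T (u ==B v) → u ≡ v
  ==B-sound {true}  {true}  _ = refl
  ==B-sound {false} {false} _ = refl

  module _ (a b c x y z : ℕ) where

    sameOrder₃-intro : (a <ᵇ b) ≡ (x <ᵇ y) → (a <ᵇ c) ≡ (x <ᵇ z) → (b <ᵇ a) ≡ (y <ᵇ x) →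
                       (b <ᵇ c) ≡ (y <ᵇ z) → (c <ᵇ a) ≡ (z <ᵇ x) → (c <ᵇ b) ≡ (z <ᵇ y) →
                       sameOrder (a ∷ b ∷ c ∷ []) (x ∷ y ∷ z ∷ []) ≡ true
    sameOrder₃-intro ab ac ba bc ca cb
      rewrite <ᵇ-irrefl a | <ᵇ-irrefl b | <ᵇ-irrefl c | <ᵇ-irrefl x | <ᵇ-irrefl y | <ᵇ-irrefl z
            | ab | ac | ba | bc | ca | cb
            | ==B-refl (x <ᵇ y) | ==B-refl (x <ᵇ z) | ==B-refl (y <ᵇ x)
            | ==B-refl (y <ᵇ z) | ==B-refl (z <ᵇ x) | ==B-refl (z <ᵇ y) = refl

    sameOrder₃-elim : sameOrder (a ∷ b ∷ c ∷ []) (x ∷ y ∷ z ∷ []) ≡ true →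
                      (a <ᵇ b) ≡ (x <ᵇ y) × (a <ᵇ c) ≡ (x <ᵇ z)
    sameOrder₃-elim order
      with _  , rest ← to (T-∧ {(a <ᵇ a) ==B (x <ᵇ x)}) (from T-≡ order)
      with ab , rest ← to (T-∧ {(a <ᵇ b) ==B (x <ᵇ y)}) rest
      with ac , _    ← to (T-∧ {(a <ᵇ c) ==B (x <ᵇ z)}) rest = ==B-sound ab , ==B-sound ac

  S₀-pattern⇒¬topMinimal : ∀ a b c {π} → π ∈ S₀ → sameOrder (a ∷ b ∷ c ∷ []) π ≡ true →
                           ¬ (a < b × a < c)
  S₀-pattern⇒¬topMinimal a b c (here refl) order (a<b , _)
    with () ← trans (sym (<ᵇ-true a<b)) (proj₁ (sameOrder₃-elim a b c 2 1 3 order))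
  S₀-pattern⇒¬topMinimal a b c (there (here refl)) order (_ , a<c)
    with () ← trans (sym (<ᵇ-true a<c)) (proj₂ (sameOrder₃-elim a b c 2 3 1 order))
  S₀-pattern⇒¬topMinimal a b c (there (there (here refl))) order (a<b , _)
    with () ← trans (sym (<ᵇ-true a<b)) (proj₁ (sameOrder₃-elim a b c 3 1 2 order))
  S₀-pattern⇒¬topMinimal a b c (there (there (there (here refl)))) order (a<b , _)
    with () ← trans (sym (<ᵇ-true a<b)) (proj₁ (sameOrder₃-elim a b c 3 2 1 order))

  ¬topMinimal⇒S₀-pattern : ∀ a b c → a ≢ b → a ≢ c → b ≢ c → ¬ (a < b × a < c) →
                           ∃[ π ] π ∈ S₀ × sameOrder (a ∷ b ∷ c ∷ []) π ≡ true
  ¬topMinimal⇒S₀-pattern a b c a≢b a≢c b≢c ¬min with <-cmp a b | <-cmp a c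
  ... | tri≈ _ a≡b _ | _            = ⊥-elim (a≢b a≡b)
  ... | _            | tri≈ _ a≡c _ = ⊥-elim (a≢c a≡c)
  ... | tri< a<b _ _ | tri< a<c _ _ = ⊥-elim (¬min (a<b , a<c))
  ... | tri< a<b _ _ | tri> _ _ c<a = _ , there (here refl) , sameOrder₃-intro a b c 2 3 1
    (<ᵇ-true a<b) (<ᵇ-false (<⇒≤ c<a)) (<ᵇ-false (<⇒≤ a<b)) (<ᵇ-false (<⇒≤ c<b)) (<ᵇ-true c<a) (<ᵇ-true c<b)
    where c<b = <-trans c<a a<b
  ... | tri> _ _ b<a | tri< a<c _ _ = _ , here refl , sameOrder₃-intro a b c 2 1 3
    (<ᵇ-false (<⇒≤ b<a)) (<ᵇ-true a<c) (<ᵇ-true b<a) (<ᵇ-true b<c) (<ᵇ-false (<⇒≤ a<c)) (<ᵇ-false (<⇒≤ b<c))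
    where b<c = <-trans b<a a<c
  ... | tri> _ _ b<a | tri> _ _ c<a with <-cmp b c
  ...   | tri≈ _ b≡c _ = ⊥-elim (b≢c b≡c)
  ...   | tri< b<c _ _ = _ , there (there (here refl)) , sameOrder₃-intro a b c 3 1 2
    (<ᵇ-false (<⇒≤ b<a)) (<ᵇ-false (<⇒≤ c<a)) (<ᵇ-true b<a) (<ᵇ-true b<c) (<ᵇ-true c<a) (<ᵇ-false (<⇒≤ b<c))
  ...   | tri> _ _ c<b = _ , there (there (there (here refl))) , sameOrder₃-intro a b c 3 2 1
    (<ᵇ-false (<⇒≤ b<a)) (<ᵇ-false (<⇒≤ c<a)) (<ᵇ-true b<a) (<ᵇ-false (<⇒≤ c<b)) (<ᵇ-true c<a) (<ᵇ-true c<b)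


module ForestReflection where

  open import Data.Nat as ℕ using (ℕ; suc; _<_)
  import Data.Nat.Properties as ℕP
  open import Data.Bool using (Bool; true; false; _∧_; not)
  import Data.Bool.Properties as BoolP
  open import Data.Bool.ListAction using (all)
  open import Data.Fin using (Fin; toℕ)
  import Data.Fin.Properties as FinP
  open import Data.Maybe using (Maybe; just; nothing; is-nothing)
  open import Data.List as List using (List; []; _∷_; map; length; allFin; upTo)
  open import Data.List.Relation.Unary.Any as Any using (here; there)
  open import Data.List.Membership.Propositional using (_∈_)
  open import Data.List.Membership.Propositional.Properties
    using (∈-concatMap⁺; ∈-concatMap⁻; ∈-map⁺; ∈-map⁻; ∈-allFin; ∈-upTo⁺)
  open import Data.Product using (∃-syntax; _×_; _,_)
  open import Data.Empty using (⊥-elim)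
  open import Function using (_⇔_; mk⇔; Equivalence)
  open import Relation.Nullary using (¬_; yes; no; contradiction)
  open import Relation.Nullary.Decidable using (decidable-stable; _×-dec_)
  open import Relation.Binary.PropositionalEquality
  open Ancestry
  open S₀Patterns
  open BoolListAction
  open Equivalence

  -- S₀ is the set of patterns of length 3 whose first entry is not the smallest.
  TopMinimal : ∀ {n} → ParentMap n → Set
  TopMinimal p = ∀ u v w → Ancestor p u v → Ancestor p v w → toℕ u < toℕ v × toℕ u < toℕ w

  isAcyclic : ∀ {n} → ParentMap n → Bool
  isAcyclic {n} p = all (λ v → is-nothing (up p n v)) (allFin n)

  isGoodForest : ∀ {n} → ParentMap n → Bool
  isGoodForest p = isAcyclic p ∧ avoids p S₀

  ∈-listsOver⁺ : ∀ {A : Set} {xs : List A} vs → (∀ {a} → a ∈ vs → a ∈ xs) → vs ∈ listsOver xs (length vs)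
  ∈-listsOver⁺ []       _      = here refl
  ∈-listsOver⁺ {xs = xs} (v ∷ vs) vs⊆xs = ∈-concatMap⁺ (λ x → map (x ∷_) (listsOver xs (length vs)))
    (Any.map (λ { refl → ∈-map⁺ (v ∷_) (∈-listsOver⁺ vs (λ a∈vs → vs⊆xs (there a∈vs))) }) (vs⊆xs (here refl)))

  ∈-listsOver⁻ : ∀ {A : Set} (xs : List A) k {vs} → vs ∈ listsOver xs k → length vs ≡ k
  ∈-listsOver⁻ xs ℕ.zero  (here refl) = refl
  ∈-listsOver⁻ xs (suc k) vs∈
    with x , ∈map ← Any.satisfied (∈-concatMap⁻ (λ x → map (x ∷_) (listsOver xs k)) {xs = xs} vs∈)
    with ws , ws∈ , refl ← ∈-map⁻ (x ∷_) ∈map = cong suc (∈-listsOver⁻ xs k ws∈)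

  S₀-length : ∀ {π} → π ∈ S₀ → length π ≡ 3
  S₀-length (here refl)                         = refl
  S₀-length (there (here refl))                 = refl
  S₀-length (there (there (here refl)))         = refl
  S₀-length (there (there (there (here refl)))) = refl

  is-nothing-sound : ∀ {A : Set} (m : Maybe A) → is-nothing m ≡ true → m ≡ nothing
  is-nothing-sound nothing _ = refl

  length≡3⇒triple : ∀ {A : Set} (vs : List A) → length vs ≡ 3 → ∃[ u ] ∃[ v ] ∃[ w ] vs ≡ u ∷ v ∷ w ∷ []
  length≡3⇒triple (u ∷ v ∷ w ∷ []) refl = u , v , w , refl

  is-justF-sound : ∀ {n} {u : Fin n} m → is-justF u m ≡ true → m ≡ just u
  is-justF-sound {u = u} (just w) eq =
    cong just (sym (FinP.toℕ-injective (ℕP.≡ᵇ⇒≡ (toℕ u) (toℕ w) (from BoolP.T-≡ eq))))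

  is-justF-refl : ∀ {n} (u : Fin n) → is-justF u (just u) ≡ true
  is-justF-refl u = to BoolP.T-≡ (ℕP.≡⇒≡ᵇ (toℕ u) (toℕ u) refl)

  module _ {n : ℕ} (p : ParentMap n) where

    isAncestor-sound : ∀ {u v} → isAncestor p u v ≡ true → Ancestor p u v
    isAncestor-sound {u} {v} h with k , _ , eq ← any-true⁻ (λ k → is-justF u (up p (suc k) v)) (upTo n) h =
      k , is-justF-sound (up p (suc k) v) eq

    isAncestor-complete : Acyclic p → ∀ {u v} → Ancestor p u v → isAncestor p u v ≡ true
    isAncestor-complete acyclic {u} {v} (k , eq) =
      any-true⁺ (λ k → is-justF u (up p (suc k) v)) (∈-upTo⁺ k<n) (trans (cong (is-justF u) eq) (is-justF-refl u))
      where
      k<n : k < n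
      k<n with k ℕP.<? n
      ... | yes k<n = k<n
      ... | no  k≮n = contradiction (trans (sym eq) (up-nothing-mono p v (ℕP.m≤n⇒m≤1+n (ℕP.≮⇒≥ k≮n))
                                                         (acyclic⇒up-n≡nothing p acyclic v)))
                                    just≢nothing

    contains₃⁺ : ∀ π → length π ≡ 3 → ∀ u v w → isAncestor p u v ≡ true → isAncestor p v w ≡ true →
                 sameOrder (toℕ u ∷ toℕ v ∷ toℕ w ∷ []) π ≡ true → contains p π ≡ true
    contains₃⁺ π len≡3 u v w uv vw order =
      any-true⁺ (λ vs → isChain p vs ∧ sameOrder (map toℕ vs) π)
        (subst (λ k → u ∷ v ∷ w ∷ [] ∈ listsOver (allFin n) k) (sym len≡3)
               (∈-listsOver⁺ (u ∷ v ∷ w ∷ []) (λ {a} _ → ∈-allFin a)))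
        (cong₂ _∧_ (cong₂ _∧_ uv (cong (_∧ true) vw)) order)

    contains₃⁻ : ∀ π → length π ≡ 3 → contains p π ≡ true →
                 ∃[ u ] ∃[ v ] ∃[ w ] isAncestor p u v ≡ true × isAncestor p v w ≡ true
                                      × sameOrder (toℕ u ∷ toℕ v ∷ toℕ w ∷ []) π ≡ true
    contains₃⁻ π len≡3 h
      with vs , vs∈ , good ← any-true⁻ (λ vs → isChain p vs ∧ sameOrder (map toℕ vs) π)
                                        (listsOver (allFin n) (length π)) h
      with u , v , w , refl ← length≡3⇒triple vs (trans (∈-listsOver⁻ (allFin n) (length π) vs∈) len≡3) =
      u , v , w , BoolP.∧-conicalˡ (isAncestor p u v) _ chain
                , BoolP.∧-conicalˡ (isAncestor p v w) true (BoolP.∧-conicalʳ (isAncestor p u v) _ chain)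
                , BoolP.∧-conicalʳ (isChain p (u ∷ v ∷ w ∷ [])) _ good
      where chain = BoolP.∧-conicalˡ (isChain p (u ∷ v ∷ w ∷ [])) _ good

    topMinimal⇒avoids : TopMinimal p → avoids p S₀ ≡ true
    topMinimal⇒avoids topMinimal = all-true⁺ (λ π → not (contains p π)) S₀ avoids-π
      where
      avoids-π : ∀ π → π ∈ S₀ → not (contains p π) ≡ true
      avoids-π π π∈S₀ with contains p π in has-π
      ... | false = refl
      ... | true with u , v , w , uv , vw , order ← contains₃⁻ π (S₀-length π∈S₀) has-π =
        ⊥-elim (S₀-pattern⇒¬topMinimal (toℕ u) (toℕ v) (toℕ w) π∈S₀ order
                  (topMinimal u v w (isAncestor-sound uv) (isAncestor-sound vw)))

    ancestor-labels-distinct : Acyclic p → ∀ {u v} → Ancestor p u v → toℕ u ≢ toℕ v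
    ancestor-labels-distinct acyclic {u} uv u≡v =
      ancestor-irrefl p acyclic u (subst (Ancestor p u) (sym (FinP.toℕ-injective u≡v)) uv)

    avoids⇒¬¬topMinimal : Acyclic p → avoids p S₀ ≡ true → ∀ {u v w} → Ancestor p u v → Ancestor p v w →
                          ¬ ¬ (toℕ u < toℕ v × toℕ u < toℕ w)
    avoids⇒¬¬topMinimal acyclic avoids-S₀ {u} {v} {w} uv vw ¬min
      with π , π∈S₀ , order ← ¬topMinimal⇒S₀-pattern (toℕ u) (toℕ v) (toℕ w)
             (ancestor-labels-distinct acyclic uv)
             (ancestor-labels-distinct acyclic (ancestor-trans p uv vw))
             (ancestor-labels-distinct acyclic vw) ¬min
      with () ← trans (sym (all-true⁻ (λ π → not (contains p π)) S₀ avoids-S₀ π∈S₀))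
                      (cong not (contains₃⁺ π (S₀-length π∈S₀) u v w
                                   (isAncestor-complete acyclic uv) (isAncestor-complete acyclic vw) order))

    avoids⇒topMinimal : Acyclic p → avoids p S₀ ≡ true → TopMinimal p
    avoids⇒topMinimal acyclic avoids-S₀ u v w uv vw =
      decidable-stable (toℕ u ℕP.<? toℕ v ×-dec toℕ u ℕP.<? toℕ w) (avoids⇒¬¬topMinimal acyclic avoids-S₀ uv vw)

    isAcyclic-sound : isAcyclic p ≡ true → Acyclic p
    isAcyclic-sound h v = n , is-nothing-sound (up p n v) (all-true⁻ (λ v → is-nothing (up p n v)) (allFin n) h (∈-allFin v))

    isAcyclic-complete : Acyclic p → isAcyclic p ≡ true
    isAcyclic-complete acyclic = all-true⁺ (λ v → is-nothing (up p n v)) (allFin n)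
      (λ v _ → cong is-nothing (acyclic⇒up-n≡nothing p acyclic v))

    isGoodForest⇔ : isGoodForest p ≡ true ⇔ (Acyclic p × TopMinimal p)
    isGoodForest⇔ = mk⇔
      (λ h → let acyclic = isAcyclic-sound (BoolP.∧-conicalˡ (isAcyclic p) _ h) in
             acyclic , avoids⇒topMinimal acyclic (BoolP.∧-conicalʳ (isAcyclic p) _ h))
      (λ (acyclic , topMinimal) → cong₂ _∧_ (isAcyclic-complete acyclic) (topMinimal⇒avoids topMinimal))

  isGoodForest-cong : ∀ {m n} {p : ParentMap m} {q : ParentMap n} →
                      (Acyclic p × TopMinimal p) ⇔ (Acyclic q × TopMinimal q) → isGoodForest p ≡ isGoodForest q
  isGoodForest-cong {p = p} {q} p⇔q = BoolP.⇔→≡ (mk⇔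
    (λ h → from (isGoodForest⇔ q) (to p⇔q (to (isGoodForest⇔ p) h)))
    (λ h → from (isGoodForest⇔ p) (from p⇔q (to (isGoodForest⇔ q) h))))


module DeleteZero where

  open import Data.Nat using (ℕ; zero; suc; z≤n; s≤s)
  open import Data.Bool using (Bool; true; false; _∧_)
  import Data.Bool.Properties as BoolP
  open import Data.Fin using (Fin)
  import Data.Fin as Fin
  open import Data.Maybe as Maybe using (Maybe; just; nothing; is-nothing; _>>=_)
  open import Data.Vec as Vec using (Vec; []; _∷_; lookup)
  open import Data.Vec.Properties using (lookup-map)
  open import Data.Product using (_,_; proj₁; proj₂)
  open import Data.Sum using (_⊎_; inj₁; inj₂)
  open import Data.Empty using (⊥; ⊥-elim)
  open import Function using (_⇔_; mk⇔; Equivalence)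
  open import Relation.Binary.PropositionalEquality
  open Ancestry
  open ForestReflection using (TopMinimal)

  module _ {n : ℕ} where

    dropZero : Maybe (Fin (suc n)) → Maybe (Fin n)
    dropZero nothing             = nothing
    dropZero (just Fin.zero)     = nothing
    dropZero (just (Fin.suc j))  = just j

    deleteZero : ∀ {m} → Vec (Maybe (Fin (suc n))) m → Vec (Maybe (Fin n)) m
    deleteZero = Vec.map dropZero

    liftParent : Maybe (Fin n) → Maybe (Fin (suc n))
    liftParent = Maybe.map Fin.suc

    isNotZero : Maybe (Fin (suc n)) → Bool
    isNotZero (just Fin.zero) = false
    isNotZero _               = true

    zeroIsLeaf : ∀ {m} → Vec (Maybe (Fin (suc n))) m → Bool
    zeroIsLeaf []      = true
    zeroIsLeaf (e ∷ w) = isNotZero e ∧ zeroIsLeaf w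

    zeroIsLeaf-lookup : ∀ {m} (w : Vec (Maybe (Fin (suc n))) m) → zeroIsLeaf w ≡ true →
                        ∀ i → isNotZero (lookup w i) ≡ true
    zeroIsLeaf-lookup (e ∷ w) h Fin.zero    = BoolP.∧-conicalˡ (isNotZero e) _ h
    zeroIsLeaf-lookup (e ∷ w) h (Fin.suc i) = zeroIsLeaf-lookup w (BoolP.∧-conicalʳ (isNotZero e) _ h) i

    zeroIsLeaf-intro : ∀ {m} (w : Vec (Maybe (Fin (suc n))) m) →
                       (∀ i → isNotZero (lookup w i) ≡ true) → zeroIsLeaf w ≡ true
    zeroIsLeaf-intro []      h = refl
    zeroIsLeaf-intro (e ∷ w) h = cong₂ _∧_ (h Fin.zero) (zeroIsLeaf-intro w (λ i → h (Fin.suc i)))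

    liftParent-dropZero : ∀ e → isNotZero e ≡ true → liftParent (dropZero e) ≡ e
    liftParent-dropZero nothing             _ = refl
    liftParent-dropZero (just (Fin.suc j))  _ = refl

    dropZero-nothing : ∀ {e} → dropZero e ≡ nothing → e ≡ nothing ⊎ e ≡ just Fin.zero
    dropZero-nothing {nothing}      _ = inj₁ refl
    dropZero-nothing {just Fin.zero} _ = inj₂ refl

    dropZero-just : ∀ {e a} → dropZero e ≡ just a → e ≡ just (Fin.suc a)
    dropZero-just {just (Fin.suc j)} refl = refl

    liftParent-nothing : ∀ {s} → liftParent s ≡ nothing → s ≡ nothing
    liftParent-nothing {nothing} _ = refl

    liftParent-just : ∀ {s a} → liftParent s ≡ just (Fin.suc a) → s ≡ just a
    liftParent-just {just x} refl = refl

    liftParent≢zero : ∀ s → liftParent s ≢ just Fin.zero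
    liftParent≢zero (just _) ()
    liftParent≢zero nothing  ()

    module _ (x : Maybe (Fin (suc n))) (w : Vec (Maybe (Fin (suc n))) n) where

      private
        p : ParentMap (suc n)
        p = x ∷ w
        q : ParentMap n
        q = deleteZero w

      up-zeroLeaf : zeroIsLeaf w ≡ true → ∀ k i → up p k (Fin.suc i) ≡ liftParent (up q k i)
      up-zeroLeaf leaf zero    i = refl
      up-zeroLeaf leaf (suc k) i with up q k i | up-zeroLeaf leaf k i
      ... | nothing | eq = cong (_>>= lookup p) eq
      ... | just j  | eq = begin
        (up p k (Fin.suc i) >>= lookup p)   ≡⟨ cong (_>>= lookup p) eq ⟩
        lookup w j                          ≡⟨ liftParent-dropZero (lookup w j) (zeroIsLeaf-lookup w leaf j) ⟨
        liftParent (dropZero (lookup w j))  ≡⟨ cong liftParent (lookup-map j dropZero w) ⟨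
        liftParent (lookup q j)             ∎
        where open ≡-Reasoning

      ancestor-zeroLeaf : zeroIsLeaf w ≡ true → ∀ {a b} → Ancestor q a b ⇔ Ancestor p (Fin.suc a) (Fin.suc b)
      ancestor-zeroLeaf leaf {a} {b} = mk⇔
        (λ (k , eq) → k , trans (up-zeroLeaf leaf (suc k) b) (cong liftParent eq))
        (λ (k , eq) → k , liftParent-just (trans (sym (up-zeroLeaf leaf (suc k) b)) eq))

      acyclic-deleteZeroLeaf : zeroIsLeaf w ≡ true → Acyclic p → Acyclic q
      acyclic-deleteZeroLeaf leaf acyclic i with k , eq ← acyclic (Fin.suc i) =
        k , liftParent-nothing (trans (sym (up-zeroLeaf leaf k i)) eq)

      topMinimal-deleteZeroLeaf : zeroIsLeaf w ≡ true → TopMinimal p → TopMinimal q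
      topMinimal-deleteZeroLeaf leaf min a b c ab bc
        with s≤s a<b , s≤s a<c ← min (Fin.suc a) (Fin.suc b) (Fin.suc c)
               (Equivalence.to (ancestor-zeroLeaf leaf) ab) (Equivalence.to (ancestor-zeroLeaf leaf) bc)
        = a<b , a<c

    module ZeroRoot (w : Vec (Maybe (Fin (suc n))) n) where

      private
        p : ParentMap (suc n)
        p = nothing ∷ w
        q : ParentMap n
        q = deleteZero w

      up-zeroRoot : ∀ k i → up q k i ≡ dropZero (up p k (Fin.suc i))
      up-zeroRoot zero    i = refl
      up-zeroRoot (suc k) i with up p k (Fin.suc i) | up-zeroRoot k i
      ... | nothing            | eq = cong (_>>= lookup q) eq
      ... | just Fin.zero      | eq = cong (_>>= lookup q) eq
      ... | just (Fin.suc j)   | eq = trans (cong (_>>= lookup q) eq) (lookup-map j dropZero w)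

      acyclic-zeroRoot : Acyclic p ⇔ Acyclic q
      acyclic-zeroRoot = mk⇔ to from
        where
        to : Acyclic p → Acyclic q
        to acyclic i with k , eq ← acyclic (Fin.suc i) = k , trans (up-zeroRoot k i) (cong dropZero eq)
        from : Acyclic q → Acyclic p
        from acyclic Fin.zero    = 1 , refl
        from acyclic (Fin.suc i) with k , eq ← acyclic i
                                 with dropZero-nothing (trans (sym (up-zeroRoot k i)) eq)
        ... | inj₁ ends    = k , ends
        ... | inj₂ at-zero = suc k , cong (_>>= lookup p) at-zero

      ancestor-zeroRoot : ∀ {a b} → Ancestor q a b ⇔ Ancestor p (Fin.suc a) (Fin.suc b)
      ancestor-zeroRoot {a} {b} = mk⇔
        (λ (k , eq) → k , dropZero-just (trans (sym (up-zeroRoot (suc k) b)) eq))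
        (λ (k , eq) → k , trans (up-zeroRoot (suc k) b) (cong dropZero eq))

      zero-has-no-ancestor : ∀ u → Ancestor p u Fin.zero → ⊥
      zero-has-no-ancestor u (k , eq) = just≢nothing (trans (sym eq) (up-suc p k Fin.zero))

      topMinimal-zeroRoot : TopMinimal p ⇔ TopMinimal q
      topMinimal-zeroRoot = mk⇔ to from
        where
        to : TopMinimal p → TopMinimal q
        to min a b c ab bc with s≤s a<b , s≤s a<c ←
          min (Fin.suc a) (Fin.suc b) (Fin.suc c) (Equivalence.to ancestor-zeroRoot ab) (Equivalence.to ancestor-zeroRoot bc)
          = a<b , a<c
        from : TopMinimal q → TopMinimal p
        from min u Fin.zero w uv _ = ⊥-elim (zero-has-no-ancestor u uv)
        from min u (Fin.suc b) Fin.zero _ vw = ⊥-elim (zero-has-no-ancestor _ vw)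
        from min Fin.zero (Fin.suc b) (Fin.suc c) _ _ = s≤s z≤n , s≤s z≤n
        from min (Fin.suc a) (Fin.suc b) (Fin.suc c) ab bc
          with a<b , a<c ← min a b c (Equivalence.from ancestor-zeroRoot ab) (Equivalence.from ancestor-zeroRoot bc)
          = s≤s a<b , s≤s a<c

    module ZeroLeaf (r : Fin n) (w : Vec (Maybe (Fin (suc n))) n) where

      private
        p : ParentMap (suc n)
        p = just (Fin.suc r) ∷ w
        q : ParentMap n
        q = deleteZero w

      parent-of-zero : Ancestor p (Fin.suc r) Fin.zero
      parent-of-zero = 0 , refl

      topMinimal⇒zeroIsLeaf : TopMinimal p → zeroIsLeaf w ≡ true
      topMinimal⇒zeroIsLeaf min = zeroIsLeaf-intro w not-zero
        where
        not-zero : ∀ i → isNotZero (lookup w i) ≡ true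
        not-zero i with lookup w i in eq
        ... | nothing            = refl
        ... | just (Fin.suc _)   = refl
        ... | just Fin.zero with () , _ ← min (Fin.suc r) Fin.zero (Fin.suc i) parent-of-zero (0 , eq)

      topMinimal⇒root : TopMinimal p → lookup w r ≡ nothing
      topMinimal⇒root min with lookup w r in eq
      ... | nothing = refl
      ... | just y with _ , () ← min y (Fin.suc r) Fin.zero (0 , eq) parent-of-zero

      module _ (leaf : zeroIsLeaf w ≡ true) (root : lookup w r ≡ nothing) where

        up-root : ∀ k → up q (suc k) r ≡ nothing
        up-root k = trans (up-suc q k r) (cong (_>>= up q k) (trans (lookup-map r dropZero w) (cong dropZero root)))

        zero-never-reached : ∀ k v → up p (suc k) v ≢ just Fin.zero
        zero-never-reached k (Fin.suc i) eq =
          liftParent≢zero (up q (suc k) i) (trans (sym (up-zeroLeaf (just (Fin.suc r)) w leaf (suc k) i)) eq)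
        zero-never-reached k Fin.zero eq = liftParent≢zero (up q k r)
          (trans (sym (up-zeroLeaf (just (Fin.suc r)) w leaf k r)) (trans (sym (up-suc p k Fin.zero)) eq))

        ancestor-of-zero : ∀ b → Ancestor p (Fin.suc b) Fin.zero → b ≡ r
        ancestor-of-zero b (zero , refl) = refl
        ancestor-of-zero b (suc k , eq) = ⊥-elim (just≢nothing (begin
          just (Fin.suc b)                  ≡⟨ eq ⟨
          up p (suc (suc k)) Fin.zero       ≡⟨ up-suc p (suc k) Fin.zero ⟩
          up p (suc k) (Fin.suc r)          ≡⟨ up-zeroLeaf (just (Fin.suc r)) w leaf (suc k) r ⟩
          liftParent (up q (suc k) r)       ≡⟨ cong liftParent (up-root k) ⟩
          nothing                           ∎))
          where open ≡-Reasoning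

        acyclic-zeroLeaf : Acyclic q → Acyclic p
        acyclic-zeroLeaf acyclic Fin.zero    = 2 , trans (up-suc p 1 Fin.zero) root
        acyclic-zeroLeaf acyclic (Fin.suc i) with k , eq ← acyclic i =
          k , trans (up-zeroLeaf (just (Fin.suc r)) w leaf k i) (cong liftParent eq)

        topMinimal-zeroLeaf : TopMinimal q → TopMinimal p
        topMinimal-zeroLeaf min Fin.zero v w′ (k , eq) _ = ⊥-elim (zero-never-reached k v eq)
        topMinimal-zeroLeaf min (Fin.suc a) Fin.zero w′ _ (k , eq) = ⊥-elim (zero-never-reached k w′ eq)
        topMinimal-zeroLeaf min (Fin.suc a) (Fin.suc b) Fin.zero ab b0
          with refl ← ancestor-of-zero b b0
          with k , eq ← Equivalence.from (ancestor-zeroLeaf (just (Fin.suc r)) w leaf) ab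
          = ⊥-elim (just≢nothing (trans (sym eq) (up-root k)))
        topMinimal-zeroLeaf min (Fin.suc a) (Fin.suc b) (Fin.suc c) ab bc
          with a<b , a<c ← min a b c (Equivalence.from (ancestor-zeroLeaf (just (Fin.suc r)) w leaf) ab)
                                     (Equivalence.from (ancestor-zeroLeaf (just (Fin.suc r)) w leaf) bc)
          = s≤s a<b , s≤s a<c

  open ForestReflection using (isGoodForest; isGoodForest⇔; isGoodForest-cong; is-nothing-sound)

  module _ {n : ℕ} (w : Vec (Maybe (Fin (suc n))) n) where

    isGoodForest-zeroRoot : isGoodForest (nothing ∷ w) ≡ isGoodForest (deleteZero w)
    isGoodForest-zeroRoot = isGoodForest-cong {p = nothing ∷ w} {q = deleteZero w} (mk⇔
      (λ (acyclic , min) → Equivalence.to acyclic-zeroRoot acyclic , Equivalence.to topMinimal-zeroRoot min)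
      (λ (acyclic , min) → Equivalence.from acyclic-zeroRoot acyclic , Equivalence.from topMinimal-zeroRoot min))
      where open ZeroRoot w

    isGoodForest-zeroLoop : isGoodForest (just Fin.zero ∷ w) ≡ false
    isGoodForest-zeroLoop with isGoodForest (just Fin.zero ∷ w) in good
    ... | false = refl
    ... | true  = ⊥-elim (ancestor-irrefl (just Fin.zero ∷ w)
                           (proj₁ (Equivalence.to (isGoodForest⇔ (just Fin.zero ∷ w)) good)) Fin.zero (0 , refl))

    isGoodForest-zeroLeaf : ∀ r → isGoodForest (just (Fin.suc r) ∷ w)
                                  ≡ zeroIsLeaf w ∧ (is-nothing (lookup w r) ∧ isGoodForest (deleteZero w))
    isGoodForest-zeroLeaf r = BoolP.⇔→≡ {z = true} (mk⇔ to from)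
      where
      open ZeroLeaf r w
      x = just (Fin.suc r)
      to : isGoodForest (x ∷ w) ≡ true → zeroIsLeaf w ∧ (is-nothing (lookup w r) ∧ isGoodForest (deleteZero w)) ≡ true
      to good = cong₂ _∧_ leaf (cong₂ _∧_ (cong is-nothing (topMinimal⇒root min))
          (Equivalence.from (isGoodForest⇔ (deleteZero w))
            (acyclic-deleteZeroLeaf x w leaf acyclic , topMinimal-deleteZeroLeaf x w leaf min)))
        where
        acyclic = proj₁ (Equivalence.to (isGoodForest⇔ (x ∷ w)) good)
        min = proj₂ (Equivalence.to (isGoodForest⇔ (x ∷ w)) good)
        leaf = topMinimal⇒zeroIsLeaf min
      from : zeroIsLeaf w ∧ (is-nothing (lookup w r) ∧ isGoodForest (deleteZero w)) ≡ true → isGoodForest (x ∷ w) ≡ true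
      from h = Equivalence.from (isGoodForest⇔ (x ∷ w))
                 (acyclic-zeroLeaf leaf root (proj₁ q-good) , topMinimal-zeroLeaf leaf root (proj₂ q-good))
        where
        leaf = BoolP.∧-conicalˡ (zeroIsLeaf w) _ h
        rest = BoolP.∧-conicalʳ (zeroIsLeaf w) _ h
        root = is-nothing-sound (lookup w r) (BoolP.∧-conicalˡ (is-nothing (lookup w r)) _ rest)
        q-good = Equivalence.to (isGoodForest⇔ (deleteZero w)) (BoolP.∧-conicalʳ (is-nothing (lookup w r)) _ rest)


module ForestCounting where

  open import Data.Nat as ℕ using (ℕ; zero; suc; _+_; _*_; _≤_; z≤n; s≤s; _≡ᵇ_)
  import Data.Nat.Properties as ℕP
  open import Data.Nat.Combinatorics using (_C_; nCk+nC[k+1]≡[n+1]C[k+1])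
  open import Data.Bool using (Bool; true; false; _∧_; T)
  import Data.Bool.Properties as BoolP
  open import Data.Fin using (Fin)
  import Data.Fin as Fin
  open import Data.Maybe using (Maybe; just; nothing; is-nothing)
  open import Data.Vec as Vec using (Vec; []; _∷_; lookup)
  open import Data.List using (List; []; _∷_; map; concatMap; length; filterᵇ; allFin)
  open import Function using (_∘_)
  open import Relation.Binary.PropositionalEquality
  open import Data.Nat.Solver using (module +-*-Solver)
  open ListSum
  open FiniteSum using (sumℕTo; sumℕTo-cong)
  open DeleteZero
  open ForestReflection using (isAcyclic; isGoodForest)

  numRoots : ∀ {A : Set} {m} → Vec (Maybe A) m → ℕ
  numRoots v = length (filterᵇ is-nothing (Vec.toList v))

  parentChoices : (n : ℕ) → List (Maybe (Fin n))
  parentChoices n = nothing ∷ map just (allFin n)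

  forestCount : ℕ → ℕ → ℕ
  forestCount n k = length (filterᵇ (λ p → ((numRoots p ≡ᵇ k) ∧ isAcyclic p) ∧ avoids p S₀) (allParentMaps n))

  weight : ∀ {n} → ℕ → ParentMap n → ℕ
  weight k p = 𝟙 (numRoots p ≡ᵇ k) * 𝟙 (isGoodForest p)

  forestCount≡sumOver-weight : ∀ n k → forestCount n k ≡ sumOver (weight k) (allParentMaps n)
  forestCount≡sumOver-weight n k = trans (length-filterᵇ _ (allParentMaps n)) (sumOver-cong (allParentMaps n) (λ p →
    trans (cong 𝟙 (BoolP.∧-assoc (numRoots p ≡ᵇ k) _ (avoids p S₀))) (𝟙-∧ (numRoots p ≡ᵇ k) (isGoodForest p))))

  sumOver-vecsOver-suc : ∀ {A : Set} (L : List A) m (φ : Vec A (suc m) → ℕ) →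
    sumOver φ (vecsOver L (suc m)) ≡ sumOver (λ x → sumOver (λ w → φ (x ∷ w)) (vecsOver L m)) L
  sumOver-vecsOver-suc L m φ = trans (sumOver-concatMap φ (λ x → map (x ∷_) (vecsOver L m)) L)
    (sumOver-cong L (λ x → sumOver-map φ (x ∷_) (vecsOver L m)))

  sumOver-parentChoices-suc : ∀ n (g : Maybe (Fin (suc n)) → ℕ) →
    sumOver g (parentChoices (suc n)) ≡ g nothing + (g (just Fin.zero) + sumOver (λ r → g (just (Fin.suc r))) (allFin n))
  sumOver-parentChoices-suc n g = cong (g nothing +_) (trans (sumOver-map g just (allFin (suc n)))
    (cong (g (just Fin.zero) +_) (sumOver-tabulate n (g ∘ just) Fin.suc)))

  liftsOf : ∀ {n} → Maybe (Fin n) → List (Maybe (Fin (suc n)))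
  liftsOf nothing  = nothing ∷ just Fin.zero ∷ []
  liftsOf (just j) = just (Fin.suc j) ∷ []

  -- all w with deleteZero w ≡ q: each root of q stays a root or becomes a child of 0
  lifts : ∀ {n m} → Vec (Maybe (Fin n)) m → List (Vec (Maybe (Fin (suc n))) m)
  lifts []      = [] ∷ []
  lifts (y ∷ q) = concatMap (λ e → map (e ∷_) (lifts q)) (liftsOf y)

  sumOver-lifts-∷ : ∀ {n m} y (q : Vec (Maybe (Fin n)) m) (φ : Vec (Maybe (Fin (suc n))) (suc m) → ℕ) →
    sumOver φ (lifts (y ∷ q)) ≡ sumOver (λ e → sumOver (λ w → φ (e ∷ w)) (lifts q)) (liftsOf y)
  sumOver-lifts-∷ y q φ = trans (sumOver-concatMap φ (λ e → map (e ∷_) (lifts q)) (liftsOf y))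
    (sumOver-cong (liftsOf y) (λ e → sumOver-map φ (e ∷_) (lifts q)))

  sumOver-liftsOf : ∀ n (g : Maybe (Fin (suc n)) → ℕ) →
    sumOver g (parentChoices (suc n)) ≡ sumOver (λ y → sumOver g (liftsOf y)) (parentChoices n)
  sumOver-liftsOf n g = begin
    sumOver g (parentChoices (suc n))
      ≡⟨ sumOver-parentChoices-suc n g ⟩
    g nothing + (g (just Fin.zero) + sumOver (λ r → g (just (Fin.suc r))) (allFin n))
      ≡⟨ solve 3 (λ a b c → a :+ (b :+ c) := (a :+ (b :+ con 0)) :+ c) refl (g nothing) (g (just Fin.zero)) _ ⟩
    (g nothing + (g (just Fin.zero) + 0)) + sumOver (λ r → g (just (Fin.suc r))) (allFin n)
      ≡⟨ cong ((g nothing + (g (just Fin.zero) + 0)) +_)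
           (trans (sumOver-cong (allFin n) (λ r → sym (ℕP.+-identityʳ _))) (sym (sumOver-map _ just (allFin n)))) ⟩
    sumOver (λ y → sumOver g (liftsOf y)) (parentChoices n) ∎
    where
    open ≡-Reasoning
    open +-*-Solver

  sumOver-vecsOver-lifts : ∀ n m (φ : Vec (Maybe (Fin (suc n))) m → ℕ) →
    sumOver φ (vecsOver (parentChoices (suc n)) m) ≡ sumOver (λ q → sumOver φ (lifts q)) (vecsOver (parentChoices n) m)
  sumOver-vecsOver-lifts n zero    φ = cong (_+ 0) (sym (ℕP.+-identityʳ (φ [])))
  sumOver-vecsOver-lifts n (suc m) φ = begin
    sumOver φ (vecsOver L′ (suc m))
      ≡⟨ sumOver-vecsOver-suc L′ m φ ⟩
    sumOver (λ x → sumOver (λ w → φ (x ∷ w)) (vecsOver L′ m)) L′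
      ≡⟨ sumOver-cong L′ (λ x → sumOver-vecsOver-lifts n m (λ w → φ (x ∷ w))) ⟩
    sumOver (λ x → sumOver (λ q → sumOver (λ w → φ (x ∷ w)) (lifts q)) (vecsOver L m)) L′
      ≡⟨ sumOver-liftsOf n _ ⟩
    sumOver (λ y → sumOver (λ x → sumOver (λ q → sumOver (λ w → φ (x ∷ w)) (lifts q)) (vecsOver L m)) (liftsOf y)) L
      ≡⟨ sumOver-cong L (λ y → sumOver-comm (λ x q → sumOver (λ w → φ (x ∷ w)) (lifts q)) (liftsOf y) (vecsOver L m)) ⟩
    sumOver (λ y → sumOver (λ q → sumOver (λ x → sumOver (λ w → φ (x ∷ w)) (lifts q)) (liftsOf y)) (vecsOver L m)) L
      ≡⟨ sumOver-cong L (λ y → sumOver-cong (vecsOver L m) (λ q → sym (sumOver-lifts-∷ y q φ))) ⟩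
    sumOver (λ y → sumOver (λ q → sumOver φ (lifts (y ∷ q))) (vecsOver L m)) L
      ≡⟨ sumOver-vecsOver-suc L m (λ q → sumOver φ (lifts q)) ⟨
    sumOver (λ q → sumOver φ (lifts q)) (vecsOver L (suc m)) ∎
    where
    open ≡-Reasoning
    L  = parentChoices n
    L′ = parentChoices (suc n)

  sumOver-lifts-deleteZero : ∀ {n m} (q : Vec (Maybe (Fin n)) m)
                               (ψ : Vec (Maybe (Fin n)) m → Vec (Maybe (Fin (suc n))) m → ℕ) →
                             sumOver (λ w → ψ (deleteZero w) w) (lifts q) ≡ sumOver (ψ q) (lifts q)
  sumOver-lifts-deleteZero []            ψ = refl
  sumOver-lifts-deleteZero (nothing ∷ q) ψ = begin
    sumOver (λ w → ψ (deleteZero w) w) (lifts (nothing ∷ q))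
      ≡⟨ sumOver-lifts-∷ nothing q (λ w → ψ (deleteZero w) w) ⟩
    sumOver (λ w → ψ (nothing ∷ deleteZero w) (nothing ∷ w)) (lifts q)
      + (sumOver (λ w → ψ (nothing ∷ deleteZero w) (just Fin.zero ∷ w)) (lifts q) + 0)
      ≡⟨ cong₂ (λ a b → a + (b + 0)) (sumOver-lifts-deleteZero q (λ q′ w → ψ (nothing ∷ q′) (nothing ∷ w)))
                                      (sumOver-lifts-deleteZero q (λ q′ w → ψ (nothing ∷ q′) (just Fin.zero ∷ w))) ⟩
    sumOver (λ w → ψ (nothing ∷ q) (nothing ∷ w)) (lifts q)
      + (sumOver (λ w → ψ (nothing ∷ q) (just Fin.zero ∷ w)) (lifts q) + 0)
      ≡⟨ sumOver-lifts-∷ nothing q (ψ (nothing ∷ q)) ⟨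
    sumOver (ψ (nothing ∷ q)) (lifts (nothing ∷ q)) ∎
    where open ≡-Reasoning
  sumOver-lifts-deleteZero (just j ∷ q) ψ = trans (sumOver-lifts-∷ (just j) q (λ w → ψ (deleteZero w) w))
    (trans (cong (_+ 0) (sumOver-lifts-deleteZero q (λ q′ w → ψ (just j ∷ q′) (just (Fin.suc j) ∷ w))))
           (sym (sumOver-lifts-∷ (just j) q (ψ (just j ∷ q)))))

  count-lifts-numRoots : ∀ {n m} (q : Vec (Maybe (Fin n)) m) k →
                         sumOver (λ w → 𝟙 (numRoots w ≡ᵇ k)) (lifts q) ≡ numRoots q C k
  count-lifts-numRoots []      zero    = refl
  count-lifts-numRoots []      (suc k) = refl
  count-lifts-numRoots (nothing ∷ q) k = trans (sumOver-lifts-∷ nothing q (λ w → 𝟙 (numRoots w ≡ᵇ k))) (split k)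
    where
    split : ∀ k → sumOver (λ w → 𝟙 (suc (numRoots w) ≡ᵇ k)) (lifts q)
                    + (sumOver (λ w → 𝟙 (numRoots w ≡ᵇ k)) (lifts q) + 0)
                  ≡ suc (numRoots q) C k
    split zero    = cong₂ _+_ (sumOver-zero (lifts q) (λ _ → refl)) (trans (ℕP.+-identityʳ _) (count-lifts-numRoots q zero))
    split (suc k) = trans (cong₂ _+_ (count-lifts-numRoots q k) (trans (ℕP.+-identityʳ _) (count-lifts-numRoots q (suc k))))
                          (nCk+nC[k+1]≡[n+1]C[k+1] (numRoots q) k)
  count-lifts-numRoots (just j ∷ q) k =
    trans (sumOver-lifts-∷ (just j) q (λ w → 𝟙 (numRoots w ≡ᵇ k))) (trans (ℕP.+-identityʳ _) (count-lifts-numRoots q k))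

  liftVec : ∀ {n m} → Vec (Maybe (Fin n)) m → Vec (Maybe (Fin (suc n))) m
  liftVec = Vec.map liftParent

  sumOver-lifts-zeroIsLeaf : ∀ {n m} (q : Vec (Maybe (Fin n)) m) (g : Vec (Maybe (Fin (suc n))) m → ℕ) →
                             sumOver (λ w → 𝟙 (zeroIsLeaf w) * g w) (lifts q) ≡ g (liftVec q)
  sumOver-lifts-zeroIsLeaf []            g = trans (ℕP.+-identityʳ _) (ℕP.+-identityʳ (g []))
  sumOver-lifts-zeroIsLeaf (nothing ∷ q) g = begin
    sumOver (λ w → 𝟙 (zeroIsLeaf w) * g w) (lifts (nothing ∷ q))
      ≡⟨ sumOver-lifts-∷ nothing q (λ w → 𝟙 (zeroIsLeaf w) * g w) ⟩
    sumOver (λ w → 𝟙 (zeroIsLeaf w) * g (nothing ∷ w)) (lifts q) + (sumOver (λ _ → 0) (lifts q) + 0)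
      ≡⟨ cong₂ _+_ (sumOver-lifts-zeroIsLeaf q (λ w → g (nothing ∷ w))) (cong (_+ 0) (sumOver-zero (lifts q) (λ _ → refl))) ⟩
    g (nothing ∷ liftVec q) + 0
      ≡⟨ ℕP.+-identityʳ _ ⟩
    g (nothing ∷ liftVec q) ∎
    where open ≡-Reasoning
  sumOver-lifts-zeroIsLeaf (just j ∷ q) g = trans (sumOver-lifts-∷ (just j) q (λ w → 𝟙 (zeroIsLeaf w) * g w))
    (trans (ℕP.+-identityʳ _) (sumOver-lifts-zeroIsLeaf q (λ w → g (just (Fin.suc j) ∷ w))))

  deleteZero-liftVec : ∀ {n m} (q : Vec (Maybe (Fin n)) m) → deleteZero (liftVec q) ≡ q
  deleteZero-liftVec []           = refl
  deleteZero-liftVec (nothing ∷ q) = cong (nothing ∷_) (deleteZero-liftVec q)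
  deleteZero-liftVec (just j ∷ q)  = cong (just j ∷_) (deleteZero-liftVec q)

  numRoots-liftVec : ∀ {n m} (q : Vec (Maybe (Fin n)) m) → numRoots (liftVec q) ≡ numRoots q
  numRoots-liftVec []            = refl
  numRoots-liftVec (nothing ∷ q) = cong suc (numRoots-liftVec q)
  numRoots-liftVec (just j ∷ q)  = numRoots-liftVec q

  is-nothing-liftVec : ∀ {n m} (q : Vec (Maybe (Fin n)) m) r → is-nothing (lookup (liftVec q) r) ≡ is-nothing (lookup q r)
  is-nothing-liftVec (nothing ∷ q) Fin.zero    = refl
  is-nothing-liftVec (just j ∷ q)  Fin.zero    = refl
  is-nothing-liftVec (e ∷ q)       (Fin.suc r) = is-nothing-liftVec q r

  numRoots≡sumOver-isRoot : ∀ {A : Set} {m} (q : Vec (Maybe A) m) →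
                            sumOver (λ r → 𝟙 (is-nothing (lookup q r))) (allFin m) ≡ numRoots q
  numRoots≡sumOver-isRoot []                   = refl
  numRoots≡sumOver-isRoot {m = suc m} (e ∷ q) =
    trans (cong (𝟙 (is-nothing e) +_) (trans (sumOver-tabulate m (λ r → 𝟙 (is-nothing (lookup (e ∷ q) r))) Fin.suc)
                                               (numRoots≡sumOver-isRoot q)))
          (head e)
    where
    head : ∀ e → 𝟙 (is-nothing e) + numRoots q ≡ numRoots (e ∷ q)
    head nothing  = refl
    head (just _) = refl

  numRoots≤length : ∀ {A : Set} {m} (q : Vec (Maybe A) m) → numRoots q ≤ m
  numRoots≤length []            = z≤n
  numRoots≤length (nothing ∷ q) = s≤s (numRoots≤length q)
  numRoots≤length (just _ ∷ q)  = ℕP.m≤n⇒m≤1+n (numRoots≤length q)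

  module ByParentOfZero (n K : ℕ) where

    private
      V = allParentMaps n

    part : Maybe (Fin (suc n)) → ℕ
    part x = sumOver (λ q → sumOver (λ w → weight K (x ∷ w)) (lifts q)) V

    sumOver-weight≡sumOver-part : sumOver (weight K) (allParentMaps (suc n)) ≡ sumOver part (parentChoices (suc n))
    sumOver-weight≡sumOver-part = trans (sumOver-vecsOver-suc (parentChoices (suc n)) n (weight K))
      (sumOver-cong (parentChoices (suc n)) (λ x → sumOver-vecsOver-lifts n n (λ w → weight K (x ∷ w))))

    zeroRootWeight : ParentMap n → ℕ
    zeroRootWeight q = sumOver (λ w → 𝟙 (suc (numRoots w) ≡ᵇ K)) (lifts q) * 𝟙 (isGoodForest q)

    part-zeroRoot : part nothing ≡ sumOver zeroRootWeight V
    part-zeroRoot = sumOver-cong V (λ q → begin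
      sumOver (λ w → roots w * 𝟙 (isGoodForest (nothing ∷ w))) (lifts q)
        ≡⟨ sumOver-cong (lifts q) (λ w → cong (λ b → roots w * 𝟙 b) (isGoodForest-zeroRoot w)) ⟩
      sumOver (λ w → roots w * 𝟙 (isGoodForest (deleteZero w))) (lifts q)
        ≡⟨ sumOver-lifts-deleteZero q (λ q′ w → roots w * 𝟙 (isGoodForest q′)) ⟩
      sumOver (λ w → roots w * 𝟙 (isGoodForest q)) (lifts q)
        ≡⟨ sumOver-cong (lifts q) (λ w → ℕP.*-comm (roots w) (𝟙 (isGoodForest q))) ⟩
      sumOver (λ w → 𝟙 (isGoodForest q) * roots w) (lifts q)
        ≡⟨ *-distribˡ-sumOver (𝟙 (isGoodForest q)) roots (lifts q) ⟨
      𝟙 (isGoodForest q) * sumOver roots (lifts q)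
        ≡⟨ ℕP.*-comm (𝟙 (isGoodForest q)) _ ⟩
      zeroRootWeight q ∎)
      where
      open ≡-Reasoning
      roots : Vec (Maybe (Fin (suc n))) n → ℕ
      roots w = 𝟙 (suc (numRoots w) ≡ᵇ K)

    part-zeroLoop : part (just Fin.zero) ≡ 0
    part-zeroLoop = sumOver-zero V (λ q → sumOver-zero (lifts q) (λ w →
      trans (cong (λ b → 𝟙 (numRoots w ≡ᵇ K) * 𝟙 b) (isGoodForest-zeroLoop w)) (ℕP.*-zeroʳ (𝟙 (numRoots w ≡ᵇ K)))))

    part-zeroLeaf : ∀ r → part (just (Fin.suc r)) ≡ sumOver (λ q → 𝟙 (is-nothing (lookup q r)) * weight K q) V
    part-zeroLeaf r = sumOver-cong V (λ q → begin
      sumOver (λ w → 𝟙 (numRoots w ≡ᵇ K) * 𝟙 (isGoodForest (just (Fin.suc r) ∷ w))) (lifts q)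
        ≡⟨ sumOver-cong (lifts q) (λ w →
             trans (cong (λ b → 𝟙 (numRoots w ≡ᵇ K) * 𝟙 b) (isGoodForest-zeroLeaf w r)) (regroup w)) ⟩
      sumOver (λ w → 𝟙 (zeroIsLeaf w) * leafWeight w) (lifts q)
        ≡⟨ sumOver-lifts-zeroIsLeaf q leafWeight ⟩
      leafWeight (liftVec q)
        ≡⟨ cong₂ (λ b m → 𝟙 b * (𝟙 (m ≡ᵇ K) * 𝟙 (isGoodForest (deleteZero (liftVec q)))))
                 (is-nothing-liftVec q r) (numRoots-liftVec q) ⟩
      𝟙 (is-nothing (lookup q r)) * (𝟙 (numRoots q ≡ᵇ K) * 𝟙 (isGoodForest (deleteZero (liftVec q))))
        ≡⟨ cong (λ q′ → 𝟙 (is-nothing (lookup q r)) * (𝟙 (numRoots q ≡ᵇ K) * 𝟙 (isGoodForest q′)))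
                (deleteZero-liftVec q) ⟩
      𝟙 (is-nothing (lookup q r)) * weight K q ∎)
      where
      open ≡-Reasoning
      open +-*-Solver
      leafWeight : Vec (Maybe (Fin (suc n))) n → ℕ
      leafWeight w = 𝟙 (is-nothing (lookup w r)) * (𝟙 (numRoots w ≡ᵇ K) * 𝟙 (isGoodForest (deleteZero w)))
      regroup : ∀ w → 𝟙 (numRoots w ≡ᵇ K) * 𝟙 (zeroIsLeaf w ∧ (is-nothing (lookup w r) ∧ isGoodForest (deleteZero w)))
                      ≡ 𝟙 (zeroIsLeaf w) * leafWeight w
      regroup w = begin
        R * 𝟙 (zeroIsLeaf w ∧ (is-nothing (lookup w r) ∧ G))
          ≡⟨ cong (R *_) (trans (𝟙-∧ (zeroIsLeaf w) _) (cong (𝟙 (zeroIsLeaf w) *_) (𝟙-∧ (is-nothing (lookup w r)) G))) ⟩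
        R * (𝟙 (zeroIsLeaf w) * (𝟙 (is-nothing (lookup w r)) * 𝟙 G))
          ≡⟨ solve 4 (λ a b c d → a :* (b :* (c :* d)) := b :* (c :* (a :* d))) refl
               R (𝟙 (zeroIsLeaf w)) (𝟙 (is-nothing (lookup w r))) (𝟙 G) ⟩
        𝟙 (zeroIsLeaf w) * leafWeight w ∎
        where
        R = 𝟙 (numRoots w ≡ᵇ K)
        G = isGoodForest (deleteZero w)

    weight*numRoots : ∀ (q : ParentMap n) → weight K q * numRoots q ≡ K * weight K q
    weight*numRoots q with numRoots q ≡ᵇ K in eq
    ... | false = sym (ℕP.*-zeroʳ K)
    ... | true  rewrite ℕP.≡ᵇ⇒≡ (numRoots q) K (subst T (sym eq) _) = ℕP.*-comm (𝟙 (isGoodForest q) + 0) K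

    sumOver-part-zeroLeaf : sumOver (λ r → part (just (Fin.suc r))) (allFin n) ≡ K * sumOver (weight K) V
    sumOver-part-zeroLeaf = begin
      sumOver (λ r → part (just (Fin.suc r))) (allFin n)
        ≡⟨ sumOver-cong (allFin n) part-zeroLeaf ⟩
      sumOver (λ r → sumOver (λ q → 𝟙 (is-nothing (lookup q r)) * weight K q) V) (allFin n)
        ≡⟨ sumOver-comm (λ r q → 𝟙 (is-nothing (lookup q r)) * weight K q) (allFin n) V ⟩
      sumOver (λ q → sumOver (λ r → 𝟙 (is-nothing (lookup q r)) * weight K q) (allFin n)) V
        ≡⟨ sumOver-cong V (λ q → begin
             sumOver (λ r → 𝟙 (is-nothing (lookup q r)) * weight K q) (allFin n)
               ≡⟨ sumOver-cong (allFin n) (λ r → ℕP.*-comm (𝟙 (is-nothing (lookup q r))) (weight K q)) ⟩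
             sumOver (λ r → weight K q * 𝟙 (is-nothing (lookup q r))) (allFin n)
               ≡⟨ *-distribˡ-sumOver (weight K q) (λ r → 𝟙 (is-nothing (lookup q r))) (allFin n) ⟨
             weight K q * sumOver (λ r → 𝟙 (is-nothing (lookup q r))) (allFin n)
               ≡⟨ cong (weight K q *_) (numRoots≡sumOver-isRoot q) ⟩
             weight K q * numRoots q
               ≡⟨ weight*numRoots q ⟩
             K * weight K q ∎) ⟩
      sumOver (λ q → K * weight K q) V
        ≡⟨ *-distribˡ-sumOver K (weight K) V ⟨
      K * sumOver (weight K) V ∎
      where open ≡-Reasoning

    decomposition : sumOver (weight K) (allParentMaps (suc n)) ≡ sumOver zeroRootWeight V + K * sumOver (weight K) V
    decomposition = begin
      sumOver (weight K) (allParentMaps (suc n))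
        ≡⟨ sumOver-weight≡sumOver-part ⟩
      sumOver part (parentChoices (suc n))
        ≡⟨ sumOver-parentChoices-suc n part ⟩
      part nothing + (part (just Fin.zero) + sumOver (λ r → part (just (Fin.suc r))) (allFin n))
        ≡⟨ cong₂ (λ a b → part nothing + (a + b)) part-zeroLoop sumOver-part-zeroLeaf ⟩
      part nothing + K * sumOver (weight K) V
        ≡⟨ cong (_+ K * sumOver (weight K) V) part-zeroRoot ⟩
      sumOver zeroRootWeight V + K * sumOver (weight K) V ∎
      where open ≡-Reasoning

  forestCount-suc-0 : ∀ n → forestCount (suc n) 0 ≡ 0
  forestCount-suc-0 n = begin
    forestCount (suc n) 0                        ≡⟨ forestCount≡sumOver-weight (suc n) 0 ⟩
    sumOver (weight 0) (allParentMaps (suc n))   ≡⟨ decomposition ⟩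
    sumOver zeroRootWeight (allParentMaps n) + 0 ≡⟨ cong (_+ 0) (sumOver-zero (allParentMaps n) no-lifts) ⟩
    0                                            ∎
    where
    open ≡-Reasoning
    open ByParentOfZero n 0
    no-lifts : ∀ q → zeroRootWeight q ≡ 0
    no-lifts q = cong (_* 𝟙 (isGoodForest q)) (sumOver-zero (lifts q) (λ _ → refl))

  forestCount-vanishes : ∀ n j → n ℕ.< j → forestCount n j ≡ 0
  forestCount-vanishes n j n<j = trans (forestCount≡sumOver-weight n j) (sumOver-zero (allParentMaps n) (λ q →
    cong (λ b → 𝟙 b * 𝟙 (isGoodForest q)) (≡ᵇ-false (ℕP.<⇒≢ (ℕP.≤-<-trans (numRoots≤length q) n<j)))))

  forestCount-suc-suc : ∀ n k → forestCount (suc n) (suc k) ≡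
                        suc k * forestCount n (suc k) + sumℕTo n (λ j → (j C k) * forestCount n j)
  forestCount-suc-suc n k = begin
    forestCount (suc n) (suc k)
      ≡⟨ forestCount≡sumOver-weight (suc n) (suc k) ⟩
    sumOver (weight (suc k)) (allParentMaps (suc n))
      ≡⟨ decomposition ⟩
    sumOver zeroRootWeight V + suc k * sumOver (weight (suc k)) V
      ≡⟨ cong₂ (λ a b → a + suc k * b) grouped (sym (forestCount≡sumOver-weight n (suc k))) ⟩
    sumℕTo n (λ j → (j C k) * forestCount n j) + suc k * forestCount n (suc k)
      ≡⟨ ℕP.+-comm _ (suc k * forestCount n (suc k)) ⟩
    suc k * forestCount n (suc k) + sumℕTo n (λ j → (j C k) * forestCount n j) ∎
    where
    open ≡-Reasoning
    open ByParentOfZero n (suc k)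
    V = allParentMaps n
    grouped : sumOver zeroRootWeight V ≡ sumℕTo n (λ j → (j C k) * forestCount n j)
    grouped = begin
      sumOver zeroRootWeight V
        ≡⟨ sumOver-cong V (λ q → cong (_* 𝟙 (isGoodForest q)) (count-lifts-numRoots q k)) ⟩
      sumOver (λ q → (numRoots q C k) * 𝟙 (isGoodForest q)) V
        ≡⟨ sumOver-groupBy n numRoots (_C k) (𝟙 ∘ isGoodForest) V numRoots≤length ⟩
      sumℕTo n (λ j → (j C k) * sumOver (weight j) V)
        ≡⟨ sumℕTo-cong n (λ j → cong ((j C k) *_) (sym (forestCount≡sumOver-weight n j))) ⟩
      sumℕTo n (λ j → (j C k) * forestCount n j) ∎


proposition3p12 : egf (numAvoidingTrees S₀) 0 ≡ 0ℚ
    × (∀ n → deriv (egf (numAvoidingTrees S₀)) n ≡ (egf (numAvoidingTrees S₀) ⊕ expS (egf (numAvoidingTrees S₀))) n)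
proposition3p12 = ForestRecurrence.ode forestCount refl forestCount-suc-0 forestCount-vanishes forestCount-suc-suc
  where open ForestCounting
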